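{- Let $D=(V+r,E)$ be a finite directed graph with root node $r\notin V$, and let $t\in V$ be a sink of $D$ (that is, no edge of $D$ leaves $t$). Then an edge set $F\subseteq E$ is a maximal flame in $D$ if and only if $F$ is the disjoint union of a maximal flame in $D-t$ (with root $r$) and a base of the matroid $\mathcal{G}_D(t)$.
   Context: For a directed graph $H$ with root $r$ and vertex $v\neq r$, $\lambda_H(r,v)$ denotes the maximum number of pairwise edge-disjoint directed paths from $r$ to $v$ in $H$, and $\varrho_H(v)$ the in-degree of $v$ in $H$. Spanning subgraphs are identified with their edge sets. A rooted digraph $F=(V+r,E_F)$ is a flame if $\lambda_F(r,v)=\varrho_F(v)$ for every $v\in V$. A maximal flame in $D=(V+r,E)$ is an edge set $F\subseteq E$ such that the spanning subgraph $(V+r,F)$ satisfies $\lambda_D(r,v)=\lambda_F(r,v)=\varrho_F(v)$ for every $v\in V$. For $v\in V$, $\mathcal{G}_D(v)$ is the matroid whose ground set is $\operatorname{in}_D(v)$, the set of edges of $D$ entering $v$, in which a subset $X\subseteq\operatorname{in}_D(v)$ is independent if and only if there exist $|X|$ pairwise edge-disjoint directed paths from $r$ to $v$ in $D$ whose last edges form exactly $X$. $D-t$ denotes the digraph obtained by deleting $t$ and its incident edges. -}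

module Defs where

open import Data.Nat using (ℕ; _≤_)
open import Data.Fin using (Fin; _≟_)
open import Data.Fin.Subset using (Subset; _∈_; _⊆_; ∣_∣; _∩_; _∪_; ⊥)
open import Data.Vec using (tabulate)
open import Data.List using (List; []; _∷_; map; last)
open import Data.List.Membership.Propositional renaming (_∈_ to _∈ₗ_)
open import Data.List.Relation.Unary.All using (All)
open import Data.List.Relation.Unary.Unique.Propositional using (Unique)
open import Data.Maybe using (Maybe; just)
open import Data.Product using (Σ; ∃; _×_; _,_)
open import Data.Sum using (_⊎_)
open import Relation.Nullary using (¬_; does)
open import Relation.Binary.PropositionalEquality using (_≡_; _≢_)

-- A finite directed (multi)graph on vertex set Fin n with edges Fin m.
-- Edge e goes from (tl e) to (hd e).  The root r is a distinguished vertex;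
-- V is the set of all other vertices.
record RootedDigraph : Set where
  field
    n    : ℕ
    m    : ℕ
    tl   : Fin m → Fin n
    hd   : Fin m → Fin n
    root : Fin n

module _ (D : RootedDigraph) where
  open RootedDigraph D

  Chain : Fin n → List (Fin m) → Fin n → Set
  Chain a []       b = a ≡ b
  Chain a (e ∷ es) b = (tl e ≡ a) × Chain (hd e) es b

  IsPath : Subset m → Fin n → Fin n → List (Fin m) → Set
  IsPath S a b p = All (λ e → e ∈ S) p × Chain a p b × Unique (a ∷ map hd p)

  EdgeDisjoint : List (Fin m) → List (Fin m) → Set
  EdgeDisjoint p q = ∀ e → e ∈ₗ p → e ∈ₗ q → Data.Empty.⊥
    where import Data.Empty

  DisjPaths : Subset m → Fin n → Fin n → (k : ℕ) → (Fin k → List (Fin m)) → Set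
  DisjPaths S a b k P =
    (∀ i → IsPath S a b (P i)) × (∀ i j → i ≢ j → EdgeDisjoint (P i) (P j))

  IsLambda : Subset m → Fin n → ℕ → Set
  IsLambda S v k =
    (Σ (Fin k → List (Fin m)) (DisjPaths S root v k)) ×
    (∀ j → Σ (Fin j → List (Fin m)) (DisjPaths S root v j) → j ≤ k)

  inEdges : Fin n → Subset m
  inEdges v = tabulate (λ e → does (hd e ≟ v))

  indeg : Subset m → Fin n → ℕ
  indeg F v = ∣ F ∩ inEdges v ∣

  -- Maximal flame in the spanning subgraph (V+r, E') of D, where only
  -- vertices v with Vtx v (v ∈ V of that graph) are constrained.
  MaxFlameIn : Subset m → (Fin n → Set) → Subset m → Set
  MaxFlameIn E' Vtx F =
    F ⊆ E' × (∀ v → v ≢ root → Vtx v →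
                IsLambda E' v (indeg F v) × IsLambda F v (indeg F v))

  allEdges : Subset m
  allEdges = tabulate (λ _ → Data.Bool.true)
    where import Data.Bool

  MaxFlame : Subset m → Set
  MaxFlame = MaxFlameIn allEdges (λ _ → Data.Unit.⊤)
    where import Data.Unit

  edgesMinus : Fin n → Subset m
  edgesMinus t = tabulate (λ e → Data.Bool.not (does (tl e ≟ t)) Data.Bool.∧ Data.Bool.not (does (hd e ≟ t)))
    where import Data.Bool

  MaxFlameMinus : Fin n → Subset m → Set
  MaxFlameMinus t = MaxFlameIn (edgesMinus t) (λ v → v ≢ t)

  IndepG : Fin n → Subset m → Set
  IndepG v X = X ⊆ inEdges v ×
    Σ (Fin ∣ X ∣ → List (Fin m)) (λ P →
      DisjPaths allEdges root v ∣ X ∣ P ×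
      (∀ e → e ∈ X → ∃ λ i → last (P i) ≡ just e) ×
      (∀ i e → last (P i) ≡ just e → e ∈ X))

  BaseG : Fin n → Subset m → Set
  BaseG v X = IndepG v X × (∀ Y → IndepG v Y → X ⊆ Y → Y ⊆ X)

  IsSink : Fin n → Set
  IsSink t = ∀ e → tl e ≢ t

{-# OPTIONS --safe #-}
module Submission where

open import Defs
open import Data.Nat using (ℕ)
open import Data.Bool using (Bool; true)
open import Data.Fin using (Fin)
open import Data.Fin.Subset using (Subset; _∩_; _∪_; ⊥)
open import Data.Product using (Σ; _×_; _,_)
open import Function.Bundles using (_⇔_; mk⇔)
open import Relation.Binary.PropositionalEquality using (_≡_; _≢_; subst; sym)

-- Since t is a sink, no path to a vertex v ≠ t uses an edge entering t, so at such v the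
-- flame conditions for F in D are those for F ∖ in(t) in D - t. At t, the last edges of
-- λ_F(t) = |F ∩ in(t)| disjoint paths make F ∩ in(t) independent in G_D(t), and no
-- independent set exceeds λ_D(t), so it is a base. Conversely, every base X has |X| = λ_D(t)
-- (augmenting the flow of X's paths would give a larger independent set containing X), and
-- F₁ ∪ X carries |X| disjoint paths: otherwise a minimum cut Z of F₁ ∪ X is entered by a
-- path of X along an edge e ∉ F₁ ∪ X whose head w differs from t; the cut W certifying
-- λ_{D-t}(w) = ϱ_{F₁}(w) contains both ends of e, and by submodularity of in-degrees Z ∪ W
-- is again a minimum cut although the tail of e is reachable in the residual graph.
-- Menger's theorem is supplied by augmenting paths.

module Counting where
  open import Data.Nat using (ℕ; zero; suc; _+_; _≤_; _<_; z≤n; s≤s)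
  open import Data.Nat.Properties hiding (_≟_; suc-injective)
  open import Data.Bool using (Bool; true; false; _∧_; _∨_; not)
  open import Data.Bool.Properties using (∧-identityʳ; ∧-zeroʳ; ∨-identityʳ; ∨-zeroʳ; ∨-assoc; not-¬; ¬-not)
  open import Data.List using (List; []; _∷_; map)
  open import Data.Nat.ListAction using () renaming (sum to listSum)
  open import Data.List.Membership.Propositional using (_∈_; _∉_)
  open import Data.List.Relation.Unary.Any using (here; there)
  open import Data.List.Relation.Unary.All as All using (All)
  open import Data.List.Relation.Unary.Unique.Propositional using (Unique)
  open import Data.List.Relation.Unary.AllPairs using ([]; _∷_)
  open import Data.Fin using (Fin; zero; suc; _≟_)
  open import Data.Fin.Properties using (suc-injective)
  open import Data.Product using (Σ; _,_)
  open import Data.Empty using (⊥-elim)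
  open import Function using (_∘_)
  open import Function.Definitions using (Injective)
  open import Relation.Nullary using (does; yes)
  open import Relation.Nullary.Decidable using (dec-true; dec-false)
  open import Relation.Binary.PropositionalEquality
  open import Algebra.Properties.CommutativeMonoid.Sum +-0-commutativeMonoid
    using (sum; sum-cong-≗; ∑-distrib-+) public
  open import Algebra.Properties.CommutativeSemigroup +-commutativeSemigroup using (x∙yz≈y∙xz)

  _==_ : ∀ {k} → Fin k → Fin k → Bool
  x == y = does (x ≟ y)

  ==-refl : ∀ {k} (x : Fin k) → (x == x) ≡ true
  ==-refl x = dec-true (x ≟ x) refl

  ≡⇒==true : ∀ {k} {x y : Fin k} → x ≡ y → (x == y) ≡ true
  ≡⇒==true {x = x} refl = ==-refl x

  ==⇒≡ : ∀ {k} {x y : Fin k} → (x == y) ≡ true → x ≡ y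
  ==⇒≡ {x = x} {y} eq with x ≟ y
  ... | yes x≡y = x≡y

  ≢⇒==false : ∀ {k} {x y : Fin k} → x ≢ y → (x == y) ≡ false
  ≢⇒==false {x = x} {y} = dec-false (x ≟ y)

  true≢false : ∀ {b} → b ≡ true → b ≢ false
  true≢false = not-¬

  χ : Bool → ℕ
  χ true = 1
  χ false = 0

  χ-mono : ∀ {a b : Bool} → (a ≡ true → b ≡ true) → χ a ≤ χ b
  χ-mono {false} _ = z≤n
  χ-mono {true} a⇒b rewrite a⇒b refl = ≤-refl

  χ≡1⇒true : ∀ {b} → χ b ≡ 1 → b ≡ true
  χ≡1⇒true {true} _ = refl

  sum-mono-≤ : ∀ {k} {f g : Fin k → ℕ} → (∀ i → f i ≤ g i) → sum f ≤ sum g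
  sum-mono-≤ {zero} _ = z≤n
  sum-mono-≤ {suc k} f≤g = +-mono-≤ (f≤g zero) (sum-mono-≤ (f≤g ∘ suc))

  sum≡0⇒≡0 : ∀ {k} {f : Fin k → ℕ} → sum f ≡ 0 → ∀ i → f i ≡ 0
  sum≡0⇒≡0 {suc k} {f} eq zero = m+n≡0⇒m≡0 (f zero) eq
  sum≡0⇒≡0 {suc k} {f} eq (suc i) = sum≡0⇒≡0 (m+n≡0⇒n≡0 (f zero) eq) i

  sum-mono-≤-rigid : ∀ {k} {f g : Fin k → ℕ} → (∀ i → f i ≤ g i) → sum g ≤ sum f → ∀ i → f i ≡ g i
  sum-mono-≤-rigid {suc k} {f} {g} f≤g ∑g≤∑f zero = ≤-antisym (f≤g zero)
    (+-cancelʳ-≤ _ (g zero) (f zero) (≤-trans ∑g≤∑f (+-monoʳ-≤ (f zero) (sum-mono-≤ (f≤g ∘ suc)))))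
  sum-mono-≤-rigid {suc k} {f} {g} f≤g ∑g≤∑f (suc i) = sum-mono-≤-rigid (f≤g ∘ suc)
    (+-cancelˡ-≤ (g zero) _ _ (≤-trans ∑g≤∑f (+-monoˡ-≤ _ (f≤g zero)))) i

  count : ∀ {k} → (Fin k → Bool) → ℕ
  count P = sum (χ ∘ P)

  count-cong : ∀ {k} {P Q : Fin k → Bool} → (∀ i → P i ≡ Q i) → count P ≡ count Q
  count-cong P≗Q = sum-cong-≗ (cong χ ∘ P≗Q)

  count-mono : ∀ {k} {P Q : Fin k → Bool} → (∀ i → P i ≡ true → Q i ≡ true) → count P ≤ count Q
  count-mono P⊆Q = sum-mono-≤ (χ-mono ∘ P⊆Q)

  count-false : ∀ {k} → count {k} (λ _ → false) ≡ 0
  count-false {zero} = refl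
  count-false {suc k} = count-false {k}

  count≤size : ∀ {k} (P : Fin k → Bool) → count P ≤ k
  count≤size {zero} P = z≤n
  count≤size {suc k} P = +-mono-≤ (χ≤1 (P zero)) (count≤size (P ∘ suc))
    where
    χ≤1 : ∀ b → χ b ≤ 1
    χ≤1 true = s≤s z≤n
    χ≤1 false = z≤n

  delete : ∀ {k} → (Fin k → Bool) → Fin k → Fin k → Bool
  delete P x i = P i ∧ not (i == x)

  delete-≢ : ∀ {k} {P : Fin k → Bool} {x i} → P i ≡ true → i ≢ x → delete P x i ≡ true
  delete-≢ {P = P} Pi i≢x rewrite Pi | ≢⇒==false i≢x = refl

  count-delete : ∀ {k} (P : Fin k → Bool) x → P x ≡ true → count P ≡ suc (count (delete P x))
  count-delete {suc k} P zero P0 rewrite P0 =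
    cong suc (count-cong λ i → sym (∧-identityʳ (P (suc i))))
  count-delete {suc k} P (suc x) Px = begin
    χ (P zero) + count (P ∘ suc)                   ≡⟨ cong (χ (P zero) +_) (count-delete (P ∘ suc) x Px) ⟩
    χ (P zero) + suc (count (delete (P ∘ suc) x))  ≡⟨ +-suc _ _ ⟩
    suc (χ (P zero) + count (delete (P ∘ suc) x))  ≡⟨ cong (λ b → suc (χ b + rest)) (∧-identityʳ (P zero)) ⟨
    suc (count (delete P (suc x)))                 ∎
    where
    open ≡-Reasoning
    rest = count (delete (P ∘ suc) x)

  count-< : ∀ {k} {P Q : Fin k → Bool} x → (∀ i → P i ≡ true → Q i ≡ true) →
    Q x ≡ true → P x ≡ false → count P < count Q
  count-< {P = P} {Q} x P⊆Q Qx ¬Px rewrite count-delete Q x Qx =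
    s≤s (count-mono λ i Pi → delete-≢ {P = Q} (P⊆Q i Pi) λ { refl → true≢false Pi ¬Px })

  injection⇒≤count : ∀ {j k} (g : Fin j → Fin k) → Injective _≡_ _≡_ g →
    (Q : Fin k → Bool) → (∀ a → Q (g a) ≡ true) → j ≤ count Q
  injection⇒≤count {zero} g g-inj Q Qg = z≤n
  injection⇒≤count {suc j} g g-inj Q Qg rewrite count-delete Q (g zero) (Qg zero) =
    s≤s (injection⇒≤count (g ∘ suc) (suc-injective ∘ g-inj) (delete Q (g zero))
          λ a → delete-≢ {P = Q} (Qg (suc a)) λ eq → 0≢suc (g-inj (sym eq)))
    where
    0≢suc : ∀ {j} {a : Fin j} → zero ≢ suc a
    0≢suc ()

  anyᶠ : ∀ {k} → (Fin k → Bool) → Bool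
  anyᶠ {zero} P = false
  anyᶠ {suc k} P = P zero ∨ anyᶠ (P ∘ suc)

  anyᶠ-witness : ∀ {k} (P : Fin k → Bool) → anyᶠ P ≡ true → Σ (Fin k) λ i → P i ≡ true
  anyᶠ-witness {suc k} P any with P zero in P0
  ... | true = zero , P0
  ... | false = let (i , Pi) = anyᶠ-witness (P ∘ suc) any in suc i , Pi

  anyᶠ-intro : ∀ {k} (P : Fin k → Bool) i → P i ≡ true → anyᶠ P ≡ true
  anyᶠ-intro P zero Pi rewrite Pi = refl
  anyᶠ-intro P (suc i) Pi with P zero
  ... | true = refl
  ... | false = anyᶠ-intro (P ∘ suc) i Pi

  anyᶠ-false : ∀ {k} (P : Fin k → Bool) → anyᶠ P ≡ false → ∀ i → P i ≡ false
  anyᶠ-false P none i = ¬-not λ Pi → true≢false (anyᶠ-intro P i Pi) none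

  anyᶠ-false-intro : ∀ {k} (P : Fin k → Bool) → (∀ i → P i ≡ false) → anyᶠ P ≡ false
  anyᶠ-false-intro {zero} P ¬P = refl
  anyᶠ-false-intro {suc k} P ¬P rewrite ¬P zero = anyᶠ-false-intro (P ∘ suc) (¬P ∘ suc)

  injection-onto : ∀ {j k} (g : Fin j → Fin k) → Injective _≡_ _≡_ g →
    (Q : Fin k → Bool) → (∀ a → Q (g a) ≡ true) → count Q ≤ j →
    ∀ e → Q e ≡ true → Σ (Fin j) λ a → g a ≡ e
  injection-onto {j} g g-inj Q Qg ∣Q∣≤j e Qe with anyᶠ (λ a → g a == e) in hit
  ... | true = let (a , ga) = anyᶠ-witness _ hit in a , ==⇒≡ ga
  ... | false = ⊥-elim (<⇒≱ j<∣Q∣ ∣Q∣≤j)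
    where
    j<∣Q∣ : j < count Q
    j<∣Q∣ rewrite count-delete Q e Qe = s≤s (injection⇒≤count g g-inj (delete Q e)
      λ a → delete-≢ {P = Q} (Qg a) λ ga≡e → true≢false (trans (cong (_== e) ga≡e) (==-refl e)) (anyᶠ-false _ hit a))

  _∈ᵇ_ : ∀ {k} → Fin k → List (Fin k) → Bool
  e ∈ᵇ [] = false
  e ∈ᵇ (x ∷ p) = (e == x) ∨ (e ∈ᵇ p)

  ∈ᵇ⇒∈ : ∀ {k} {e : Fin k} p → (e ∈ᵇ p) ≡ true → e ∈ p
  ∈ᵇ⇒∈ {e = e} (x ∷ p) e∈ with e == x in e≡x
  ... | true = here (==⇒≡ e≡x)
  ... | false = there (∈ᵇ⇒∈ p e∈)

  ∈⇒∈ᵇ : ∀ {k} {e : Fin k} p → e ∈ p → (e ∈ᵇ p) ≡ true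
  ∈⇒∈ᵇ {e = e} (x ∷ p) (here refl) rewrite ==-refl e = refl
  ∈⇒∈ᵇ {e = e} (x ∷ p) (there e∈) rewrite ∈⇒∈ᵇ p e∈ = ∨-zeroʳ (e == x)

  ∉⇒∈ᵇfalse : ∀ {k} {e : Fin k} p → e ∉ p → (e ∈ᵇ p) ≡ false
  ∉⇒∈ᵇfalse p e∉ = ¬-not λ e∈ → e∉ (∈ᵇ⇒∈ p e∈)

  sumAlong : ∀ {A : Set} → (A → ℕ) → List A → ℕ
  sumAlong g p = listSum (map g p)

  crossing-balance : ∀ a b → χ (not a ∧ b) + χ a ≡ χ (a ∧ not b) + χ b
  crossing-balance true true = refl
  crossing-balance true false = refl
  crossing-balance false true = refl
  crossing-balance false false = refl

  telescope : ∀ x y x′ y′ a b c → x + a ≡ y + b → x′ + b ≡ y′ + c → x + x′ + a ≡ y + y′ + c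
  telescope x y x′ y′ a b c first rest = begin
    x + x′ + a    ≡⟨ cong (_+ a) (+-comm x x′) ⟩
    x′ + x + a    ≡⟨ +-assoc x′ x a ⟩
    x′ + (x + a)  ≡⟨ cong (x′ +_) first ⟩
    x′ + (y + b)  ≡⟨ x∙yz≈y∙xz x′ y b ⟩
    y + (x′ + b)  ≡⟨ cong (y +_) rest ⟩
    y + (y′ + c)  ≡⟨ +-assoc y y′ c ⟨
    y + y′ + c    ∎
    where open ≡-Reasoning

  count-insert : ∀ {k} (f c : Fin k → Bool) x → f x ≡ false →
    count (λ e → (f e ∨ (e == x)) ∧ c e) ≡ count (λ e → f e ∧ c e) + χ (c x)
  count-insert f c x fx with c x in cx
  ... | true = begin
    count (λ e → (f e ∨ (e == x)) ∧ c e)                   ≡⟨ count-delete _ x x∈ ⟩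
    suc (count (delete (λ e → (f e ∨ (e == x)) ∧ c e) x))  ≡⟨ cong suc (count-cong deleted) ⟩
    suc (count (λ e → f e ∧ c e))                          ≡⟨ +-comm 1 _ ⟩
    count (λ e → f e ∧ c e) + 1                            ∎
    where
    open ≡-Reasoning
    x∈ : (f x ∨ (x == x)) ∧ c x ≡ true
    x∈ rewrite ==-refl x | ∨-zeroʳ (f x) = cx
    deleted : ∀ e → ((f e ∨ (e == x)) ∧ c e) ∧ not (e == x) ≡ f e ∧ c e
    deleted e with e == x in e≡x
    ... | true with refl ← ==⇒≡ {x = e} e≡x rewrite fx = ∧-zeroʳ _
    ... | false rewrite ∨-identityʳ (f e) = ∧-identityʳ _
  ... | false = trans (count-cong unchanged) (sym (+-identityʳ _))
    where
    unchanged : ∀ e → (f e ∨ (e == x)) ∧ c e ≡ f e ∧ c e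
    unchanged e with e == x in e≡x
    ... | true with refl ← ==⇒≡ {x = e} e≡x rewrite fx | cx = refl
    ... | false rewrite ∨-identityʳ (f e) = refl

  count-∪-list : ∀ {k} (f c : Fin k → Bool) (p : List (Fin k)) → Unique p → (∀ e → e ∈ p → f e ≡ false) →
    count (λ e → (f e ∨ (e ∈ᵇ p)) ∧ c e) ≡ count (λ e → f e ∧ c e) + sumAlong (χ ∘ c) p
  count-∪-list f c [] _ _ = trans (count-cong λ e → cong (_∧ c e) (∨-identityʳ (f e))) (sym (+-identityʳ _))
  count-∪-list f c (x ∷ p) (x∉p ∷ uniq) disjoint = begin
    count (λ e → (f e ∨ ((e == x) ∨ (e ∈ᵇ p))) ∧ c e)
      ≡⟨ count-cong (λ e → cong (_∧ c e) (∨-assoc (f e) (e == x) (e ∈ᵇ p))) ⟨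
    count (λ e → ((f e ∨ (e == x)) ∨ (e ∈ᵇ p)) ∧ c e)
      ≡⟨ count-∪-list (λ e → f e ∨ (e == x)) c p uniq disjoint′ ⟩
    count (λ e → (f e ∨ (e == x)) ∧ c e) + sumAlong (χ ∘ c) p
      ≡⟨ cong (_+ sumAlong (χ ∘ c) p) (count-insert f c x (disjoint x (here refl))) ⟩
    count (λ e → f e ∧ c e) + χ (c x) + sumAlong (χ ∘ c) p
      ≡⟨ +-assoc (count (λ e → f e ∧ c e)) (χ (c x)) _ ⟩
    count (λ e → f e ∧ c e) + sumAlong (χ ∘ c) (x ∷ p) ∎
    where
    open ≡-Reasoning
    disjoint′ : ∀ e → e ∈ p → (f e ∨ (e == x)) ≡ false
    disjoint′ e e∈p rewrite disjoint e (there e∈p) = ≢⇒==false {x = e} {x} λ { refl → All.lookup x∉p e∈p refl }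

  count-∖-list : ∀ {k} (f c : Fin k → Bool) (p : List (Fin k)) → Unique p → (∀ e → e ∈ p → f e ≡ true) →
    count (λ e → f e ∧ c e) ≡ count (λ e → (f e ∧ not (e ∈ᵇ p)) ∧ c e) + sumAlong (χ ∘ c) p
  count-∖-list f c p uniq p⊆f =
    trans (count-cong split) (count-∪-list (λ e → f e ∧ not (e ∈ᵇ p)) c p uniq removed)
    where
    removed : ∀ e → e ∈ p → (f e ∧ not (e ∈ᵇ p)) ≡ false
    removed e e∈p rewrite ∈⇒∈ᵇ p e∈p = ∧-zeroʳ _
    split : ∀ e → f e ∧ c e ≡ ((f e ∧ not (e ∈ᵇ p)) ∨ (e ∈ᵇ p)) ∧ c e
    split e with e ∈ᵇ p in e∈
    ... | true rewrite p⊆f e (∈ᵇ⇒∈ p e∈) = refl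
    ... | false rewrite ∧-identityʳ (f e) | ∨-identityʳ (f e) = refl

module Walks {N : ℕ} {A : Set} (src dst : A → Fin N) where
  open import Data.Nat using (_+_)
  open import Data.Bool using (Bool; true; false; _∧_; not)
  open import Data.Fin using (Fin)
  open import Data.List using (List; []; _∷_)
  open import Data.Product using (Σ; _×_; _,_)
  open import Data.Empty using (⊥-elim)
  open import Data.List.Membership.Propositional using (_∈_)
  open import Data.List.Relation.Unary.Any using (here; there)
  open import Data.Nat.Properties using (+-comm)
  open import Function using (_∘_)
  open import Relation.Binary.PropositionalEquality
  open Counting

  -- RevChain a L b: L lists the arcs of a walk from a to b backwards, last arc first.
  RevChain : Fin N → List A → Fin N → Set
  RevChain a [] b = b ≡ a
  RevChain a (α ∷ L) b = (dst α ≡ b) × RevChain a L (src α)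

  arcEnters : (Fin N → Bool) → A → Bool
  arcEnters Z α = not (Z (src α)) ∧ Z (dst α)

  arcLeaves : (Fin N → Bool) → A → Bool
  arcLeaves Z α = Z (src α) ∧ not (Z (dst α))

  revChain-crossings : (Z : Fin N → Bool) → ∀ {a L b} → RevChain a L b →
    sumAlong (χ ∘ arcEnters Z) L + χ (Z a) ≡ sumAlong (χ ∘ arcLeaves Z) L + χ (Z b)
  revChain-crossings Z {L = []} refl = refl
  revChain-crossings Z {a} {α ∷ L} (refl , chain) = begin
    χ (arcEnters Z α) + E + χ (Z a)         ≡⟨ cong (_+ χ (Z a)) (+-comm (χ (arcEnters Z α)) E) ⟩
    E + χ (arcEnters Z α) + χ (Z a)         ≡⟨ telescope E O _ _ _ _ _ (revChain-crossings Z chain) step ⟩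
    O + χ (arcLeaves Z α) + χ (Z (dst α))   ≡⟨ cong (_+ χ (Z (dst α))) (+-comm O (χ (arcLeaves Z α))) ⟩
    χ (arcLeaves Z α) + O + χ (Z (dst α))   ∎
    where
    open ≡-Reasoning
    E = sumAlong (χ ∘ arcEnters Z) L
    O = sumAlong (χ ∘ arcLeaves Z) L
    step = crossing-balance (Z (src α)) (Z (dst α))

  revChain-enters : (Z : Fin N → Bool) → ∀ {a L b} → RevChain a L b → Z a ≡ false → Z b ≡ true →
    Σ A λ α → α ∈ L × arcEnters Z α ≡ true
  revChain-enters Z {L = []} refl Za Zb = ⊥-elim (true≢false Zb Za)
  revChain-enters Z {L = α ∷ L} (refl , chain) Za Zb with Z (src α) in Zsrc
  ... | false = α , here refl , trans (cong (λ b → not b ∧ Z (dst α)) Zsrc) Zb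
  ... | true = let (β , β∈ , enters-β) = revChain-enters Z chain Za Zsrc in β , there β∈ , enters-β

module Reachability {N : ℕ} {A : Set} (src dst : A → Fin N) (usable : A → Bool)
  (anyArc : (A → Bool) → Bool)
  (anyArc-witness : ∀ P → anyArc P ≡ true → Σ A λ α → P α ≡ true)
  (anyArc-intro : ∀ P α → P α ≡ true → anyArc P ≡ true)
  (s : Fin N) where
  open import Data.Nat using (ℕ; zero; suc; _≤_; z≤n; s≤s)
  open import Data.Bool using (Bool; true; false; _∧_; _∨_; not)
  open import Data.Fin using (Fin)
  open import Data.Product using (Σ; _×_; _,_; proj₁)
  open import Relation.Binary.PropositionalEquality
  open import Data.Nat.Properties using (≤-trans; <⇒≱; m≤n⇒m<n∨m≡n)
  open import Data.Bool.Properties using (∧-conicalˡ; ∧-conicalʳ; not-injective)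
  open import Data.List using (List; []; _∷_; map)
  open import Data.List.Relation.Unary.All as All using (All; []; _∷_)
  open import Data.List.Relation.Unary.Unique.Propositional using (Unique)
  open import Data.List.Relation.Unary.AllPairs using ([]; _∷_)
  open import Data.Sum using (_⊎_; inj₁; inj₂)
  open import Data.Empty using (⊥-elim)
  open Counting
  open Walks src dst public

  arcInto : (Fin N → Bool) → Fin N → Bool
  arcInto R u = anyArc λ α → usable α ∧ (R (src α) ∧ (dst α == u))

  layer : ℕ → Fin N → Bool
  layer zero u = u == s
  layer (suc i) u = layer i u ∨ arcInto (layer i) u

  RevPath : Fin N → Set
  RevPath u = Σ (List A) λ L →
    RevChain s L u × All (λ α → usable α ≡ true) L × Unique (u ∷ map src L)

  layer-suc : ∀ i u → layer i u ≡ true → layer (suc i) u ≡ true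
  layer-suc i u u∈ rewrite u∈ = refl

  layer-mono : ∀ {i j} u → i ≤ j → layer i u ≡ true → layer j u ≡ true
  layer-mono {j = zero} u z≤n u∈ = u∈
  layer-mono {j = suc j} u i≤j u∈ with m≤n⇒m<n∨m≡n i≤j
  ... | inj₁ (s≤s i≤j′) = layer-suc j u (layer-mono u i≤j′ u∈)
  ... | inj₂ refl = u∈

  layer-source : ∀ i → layer i s ≡ true
  layer-source i = layer-mono {j = i} s z≤n (==-refl s)

  -- The extra invariant that the whole path lies in layer i is what keeps it simple.
  revPathInLayer : ∀ i u → layer i u ≡ true →
    Σ (RevPath u) λ P → All (λ x → layer i x ≡ true) (u ∷ map src (proj₁ P))
  revPathInLayer zero u u∈ with refl ← ==⇒≡ {x = u} u∈ =
    ([] , refl , [] , [] ∷ []) , u∈ ∷ []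
  revPathInLayer (suc i) u u∈ with layer i u in old
  ... | true = let (P , in-i) = revPathInLayer i u old in
    P , All.map (λ {x} → layer-suc i x) in-i
  ... | false =
    let (α , hit) = anyArc-witness _ u∈
        src∈ = ∧-conicalˡ _ _ (∧-conicalʳ (usable α) _ hit)
        ((L , chain , ok , uniq) , in-i) = revPathInLayer i (src α) src∈
        fresh = All.map (λ {x} x∈ u≡x → true≢false (subst (λ z → layer i z ≡ true) (sym u≡x) x∈) old) in-i
    in ((α ∷ L) , (==⇒≡ (∧-conicalʳ _ _ (∧-conicalʳ (usable α) _ hit)) , chain) ,
        (∧-conicalˡ _ _ hit ∷ ok) , fresh ∷ uniq) ,
       trans (cong (_∨ arcInto (layer i) u) old) u∈ ∷ All.map (λ {x} → layer-suc i x) in-i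

  Closed : (Fin N → Bool) → Set
  Closed R = ∀ α → usable α ≡ true → R (src α) ≡ true → R (dst α) ≡ true

  layers-stabilise : ∀ i → (Σ ℕ λ j → ∀ u → layer (suc j) u ≡ true → layer j u ≡ true) ⊎ (i ≤ count (layer i))
  layers-stabilise zero = inj₂ z≤n
  layers-stabilise (suc i) with layers-stabilise i
  ... | inj₁ stable = inj₁ stable
  ... | inj₂ i≤∣layer∣ with anyᶠ (λ u → layer (suc i) u ∧ not (layer i u)) in new
  ... | true = let (u , u-new) = anyᶠ-witness _ new in
    inj₂ (≤-trans (s≤s i≤∣layer∣)
      (count-< u (λ x → layer-suc i x) (∧-conicalˡ _ _ u-new) (not-injective (∧-conicalʳ _ _ u-new))))
  ... | false = inj₁ (i , λ u u∈ → old u u∈ (anyᶠ-false _ new u))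
    where
    old : ∀ u → layer (suc i) u ≡ true → layer (suc i) u ∧ not (layer i u) ≡ false → layer i u ≡ true
    old u u∈ not-new with layer i u
    ... | true = refl
    ... | false rewrite u∈ = ⊥-elim (true≢false refl not-new)

  record Reach : Set where
    field
      R : Fin N → Bool
      R-source : R s ≡ true
      R-closed : Closed R
      R-path : ∀ u → R u ≡ true → RevPath u

  reach : Reach
  reach with layers-stabilise (suc N)
  ... | inj₂ N<∣layer∣ = ⊥-elim (<⇒≱ (s≤s (count≤size (layer (suc N)))) N<∣layer∣)
  ... | inj₁ (j , stable) = record
    { R = layer j
    ; R-source = layer-source j
    ; R-closed = λ α ok src∈ → stable (dst α) (step α ok src∈)
    ; R-path = λ u u∈ → proj₁ (revPathInLayer j u u∈) }
    where
    step : ∀ α → usable α ≡ true → layer j (src α) ≡ true → layer (suc j) (dst α) ≡ true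
    step α ok src∈ with layer j (dst α)
    ... | true = refl
    ... | false = anyArc-intro _ α (trans (cong₂ _∧_ ok (cong₂ _∧_ src∈ (==-refl (dst α)))) refl)

module SubsetLookup where
  open import Data.Nat using (suc; _≤_)
  open import Data.Nat.Properties using (<⇒≱)
  open import Data.Product using (_,_)
  open import Data.Empty using (⊥-elim)
  open import Relation.Nullary using (yes; no)
  open import Data.Fin.Subset.Properties
    using ( _∈?_; p⊂q⇒∣p∣<∣q∣; ∩-identityʳ; ∪-inverseˡ; ∩-distribˡ-∪
          ; ∩-assoc; ∩-comm; ∩-inverseˡ; ∩-zeroˡ; ∩-zeroʳ )
  open import Data.Bool using (true; false; _∧_; _∨_; not)
  open import Data.Fin using (Fin)
  open import Data.Fin.Subset using (Subset; _∈_; _⊆_; ∣_∣; _∩_; _∪_; ∁; ⊤; ⊥)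
  open import Data.Vec using ([]; _∷_; lookup)
  open import Data.Vec.Properties using ([]=⇒lookup; lookup⇒[]=; lookup-zipWith; lookup-map)
  open import Relation.Binary.PropositionalEquality
  open Counting

  ∈⇒lookup : ∀ {k} {e : Fin k} {S : Subset k} → e ∈ S → lookup S e ≡ true
  ∈⇒lookup = []=⇒lookup

  lookup⇒∈ : ∀ {k} {e : Fin k} {S : Subset k} → lookup S e ≡ true → e ∈ S
  lookup⇒∈ {e = e} {S} = lookup⇒[]= e S

  ∣∣≡count : ∀ {k} (S : Subset k) → ∣ S ∣ ≡ count (lookup S)
  ∣∣≡count [] = refl
  ∣∣≡count (true ∷ S) = cong suc (∣∣≡count S)
  ∣∣≡count (false ∷ S) = ∣∣≡count S

  lookup-∩ : ∀ {k} (p q : Subset k) i → lookup (p ∩ q) i ≡ lookup p i ∧ lookup q i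
  lookup-∩ p q i = lookup-zipWith _∧_ i p q

  lookup-∪ : ∀ {k} (p q : Subset k) i → lookup (p ∪ q) i ≡ lookup p i ∨ lookup q i
  lookup-∪ p q i = lookup-zipWith _∨_ i p q

  lookup-∁ : ∀ {k} (p : Subset k) i → lookup (∁ p) i ≡ not (lookup p i)
  lookup-∁ p i = lookup-map i not p

  ⊆-card-≤⇒⊇ : ∀ {k} {A B : Subset k} → A ⊆ B → ∣ B ∣ ≤ ∣ A ∣ → B ⊆ A
  ⊆-card-≤⇒⊇ {A = A} {B} A⊆B ∣B∣≤∣A∣ {e} e∈B with e ∈? A
  ... | yes e∈A = e∈A
  ... | no e∉A = ⊥-elim (<⇒≱ (p⊂q⇒∣p∣<∣q∣ (A⊆B , e , e∈B , e∉A)) ∣B∣≤∣A∣)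

  split-by : ∀ {k} (F A : Subset k) → F ≡ (F ∩ ∁ A) ∪ (F ∩ A)
  split-by F A = begin
    F                       ≡⟨ ∩-identityʳ F ⟨
    F ∩ ⊤                   ≡⟨ cong (F ∩_) (∪-inverseˡ A) ⟨
    F ∩ (∁ A ∪ A)           ≡⟨ ∩-distribˡ-∪ F (∁ A) A ⟩
    (F ∩ ∁ A) ∪ (F ∩ A)     ∎
    where open ≡-Reasoning

  split-by-disjoint : ∀ {k} (F A : Subset k) → (F ∩ ∁ A) ∩ (F ∩ A) ≡ ⊥
  split-by-disjoint F A = begin
    (F ∩ ∁ A) ∩ (F ∩ A)     ≡⟨ ∩-assoc F (∁ A) (F ∩ A) ⟩
    F ∩ (∁ A ∩ (F ∩ A))     ≡⟨ cong (λ X → F ∩ (∁ A ∩ X)) (∩-comm F A) ⟩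
    F ∩ (∁ A ∩ (A ∩ F))     ≡⟨ cong (F ∩_) (∩-assoc (∁ A) A F) ⟨
    F ∩ ((∁ A ∩ A) ∩ F)     ≡⟨ cong (λ X → F ∩ (X ∩ F)) (∩-inverseˡ A) ⟩
    F ∩ (⊥ ∩ F)             ≡⟨ cong (F ∩_) (∩-zeroˡ F) ⟩
    F ∩ ⊥                   ≡⟨ ∩-zeroʳ F ⟩
    ⊥                       ∎
    where open ≡-Reasoning

module Flows (D : RootedDigraph) where
  open import Data.Nat using (ℕ; zero; suc; _+_; _*_; _≤_; _<_; z≤n)
  open import Data.Nat.Properties hiding (_≟_; suc-injective)
  open import Data.Nat.Tactic.RingSolver using (solve-∀)
  open import Data.Bool using (Bool; true; false; _∧_; _∨_; not)
  open import Data.Bool.Properties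
    using (∧-conicalˡ; ∧-conicalʳ; ∧-zeroʳ; ∧-identityʳ; ∧-comm; ∨-comm; ∨-zeroʳ; not-injective; ¬-not)
  open import Data.Fin using (Fin; zero; suc; _≟_; inject≤)
  open import Data.Fin.Properties using (suc-injective; inject≤-injective)
  open import Data.List using (List; []; _∷_; map; last)
  open import Data.Maybe using (just)
  open import Data.List.Membership.Propositional using (_∈_; _∉_)
  open import Data.List.Relation.Unary.Any using (here; there)
  open import Data.List.Relation.Unary.All as All using (All; []; _∷_)
  open import Data.List.Relation.Unary.All.Properties using (¬Any⇒All¬)
  open import Data.List.Relation.Unary.Unique.Propositional using (Unique)
  open import Data.List.Relation.Unary.AllPairs as AllPairs using ([]; _∷_)
  import Data.List.Relation.Unary.Unique.Propositional.Properties as Unique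
  open import Data.Product using (Σ; _×_; _,_; proj₁; proj₂)
  open import Data.Empty using (⊥-elim) renaming (⊥ to Empty)
  open import Data.Sum using (_⊎_; inj₁; inj₂)
  open import Function using (_∘_)
  open import Function.Definitions using (Injective)
  open import Relation.Nullary using (yes; no)
  open import Relation.Binary.PropositionalEquality
  open import Data.Fin.Subset using (_∩_)
  open import Data.Vec using (lookup)
  open import Data.Vec.Properties using (lookup∘tabulate)
  open import Algebra.Properties.CommutativeSemigroup +-commutativeSemigroup using (x∙yz≈y∙xz)
  open Counting
  open SubsetLookup
  open RootedDigraph D

  EdgeSet : Set
  EdgeSet = Fin m → Bool

  VertexSet : Set
  VertexSet = Fin n → Bool

  _⊆ᵉ_ : EdgeSet → EdgeSet → Set
  S ⊆ᵉ S′ = ∀ e → S e ≡ true → S′ e ≡ true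

  enters : VertexSet → Fin m → Bool
  enters Z e = not (Z (tl e)) ∧ Z (hd e)

  leaves : VertexSet → Fin m → Bool
  leaves Z e = Z (tl e) ∧ not (Z (hd e))

  ϱ : EdgeSet → VertexSet → ℕ
  ϱ f Z = count λ e → f e ∧ enters Z e

  δ : EdgeSet → VertexSet → ℕ
  δ f Z = count λ e → f e ∧ leaves Z e

  -- A unit-capacity flow of value k from the root to v inside S. Conservation is stated
  -- across cuts rather than at vertices, the form in which it telescopes along paths.
  record Flow (S : EdgeSet) (v : Fin n) (k : ℕ) (f : EdgeSet) : Set where
    constructor flow
    field
      ⊆S : f ⊆ᵉ S
      balance : ∀ Z → Z root ≡ false → ϱ f Z ≡ δ f Z + χ (Z v) * k

  Path : EdgeSet → Fin n → Fin n → List (Fin m) → Set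
  Path S a b p = (∀ e → e ∈ p → S e ≡ true) × Chain D a p b × Unique (a ∷ map hd p)

  DisjointPaths : EdgeSet → Fin n → (k : ℕ) → (Fin k → List (Fin m)) → Set
  DisjointPaths S v k P = (∀ i → Path S root v (P i)) × (∀ i j → i ≢ j → EdgeDisjoint D (P i) (P j))

  path-mono : ∀ {S S′ a b p} → S ⊆ᵉ S′ → Path S a b p → Path S′ a b p
  path-mono S⊆S′ (p⊆S , chain , uniq) = (λ e e∈p → S⊆S′ e (p⊆S e e∈p)) , chain , uniq

  disjointPaths-mono : ∀ {S S′ v k P} → S ⊆ᵉ S′ → DisjointPaths S v k P → DisjointPaths S′ v k P
  disjointPaths-mono S⊆S′ (paths , disjoint) = path-mono S⊆S′ ∘ paths , disjoint

  edges-unique : ∀ {a p} → Unique (a ∷ map hd p) → Unique p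
  edges-unique (_ ∷ uniq) = Unique.map⁻ uniq

  chain-last : ∀ {a p b} → Chain D a p b → a ≢ b → Σ (Fin m) λ e → last p ≡ just e × e ∈ p × hd e ≡ b
  chain-last {p = []} refl a≢b = ⊥-elim (a≢b refl)
  chain-last {p = e ∷ p} chain _ = nonempty chain
    where
    nonempty : ∀ {a e p b} → Chain D a (e ∷ p) b → Σ (Fin m) λ x → last (e ∷ p) ≡ just x × x ∈ e ∷ p × hd x ≡ b
    nonempty {e = e} {[]} (_ , refl) = e , refl , here refl , refl
    nonempty {p = e′ ∷ p} (_ , chain) =
      let (x , last≡ , x∈ , hd≡) = nonempty chain in x , last≡ , there x∈ , hd≡

  disjointPaths-take : ∀ {S v j k P} (k≤j : k ≤ j) → DisjointPaths S v j P → DisjointPaths S v k (P ∘ λ i → inject≤ i k≤j)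
  disjointPaths-take k≤j (paths , disjoint) =
    (λ i → paths (inject≤ i k≤j)) , λ i i′ i≢i′ → disjoint _ _ (i≢i′ ∘ inject≤-injective k≤j k≤j i i′)

  chain-crossings : (Z : VertexSet) → ∀ {a p b} → Chain D a p b →
    sumAlong (χ ∘ enters Z) p + χ (Z a) ≡ sumAlong (χ ∘ leaves Z) p + χ (Z b)
  chain-crossings Z {p = []} refl = refl
  chain-crossings Z {p = e ∷ p} (refl , chain) =
    telescope (χ (enters Z e)) (χ (leaves Z e)) _ _ _ _ _
      (crossing-balance (Z (tl e)) (Z (hd e))) (chain-crossings Z chain)

  root-chain-crossings : (Z : VertexSet) → Z root ≡ false → ∀ {p b} → Chain D root p b →
    sumAlong (χ ∘ enters Z) p ≡ sumAlong (χ ∘ leaves Z) p + χ (Z b)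
  root-chain-crossings Z Zr {p} {b} chain = trans (sym (+-identityʳ _))
    (subst (λ x → sumAlong (χ ∘ enters Z) p + χ x ≡ sumAlong (χ ∘ leaves Z) p + χ (Z b)) Zr (chain-crossings Z chain))

  _∪ₗ_ : EdgeSet → List (Fin m) → EdgeSet
  (f ∪ₗ p) e = f e ∨ (e ∈ᵇ p)

  _∖ₗ_ : EdgeSet → List (Fin m) → EdgeSet
  (f ∖ₗ p) e = f e ∧ not (e ∈ᵇ p)

  flow-cong : ∀ {S v k f g} → (∀ e → f e ≡ g e) → Flow S v k f → Flow S v k g
  flow-cong f≗g (flow ⊆S balance) = flow
    (λ e ge → ⊆S e (trans (f≗g e) ge))
    (λ Z Zr → trans (sym (count-cong λ e → cong (_∧ enters Z e) (f≗g e)))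
             (trans (balance Z Zr) (cong (_+ _) (count-cong λ e → cong (_∧ leaves Z e) (f≗g e)))))

  empty-flow : ∀ S v → Flow S v 0 (λ _ → false)
  empty-flow S v = flow (λ _ ()) λ Z _ → trans (count-false {m})
    (sym (trans (cong (_+ χ (Z v) * 0) (count-false {m})) (*-zeroʳ (χ (Z v)))))

  path-arith : ∀ d o z k → d + z * k + (o + z) ≡ d + o + z * suc k
  path-arith = solve-∀

  add-path : ∀ {S v k f} p → Flow S v k f → Path S root v p → (∀ e → e ∈ p → f e ≡ false) →
    Flow S v (suc k) (f ∪ₗ p)
  add-path {S} {v} {k} {f} p (flow ⊆S balance) (p⊆S , chain , uniq) disjoint = flow ⊆S′ balance′
    where
    ⊆S′ : (f ∪ₗ p) ⊆ᵉ S
    ⊆S′ e e∈ with f e in fe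
    ... | true = ⊆S e fe
    ... | false = p⊆S e (∈ᵇ⇒∈ p e∈)
    balance′ : ∀ Z → Z root ≡ false → ϱ (f ∪ₗ p) Z ≡ δ (f ∪ₗ p) Z + χ (Z v) * suc k
    balance′ Z Zr = begin
      ϱ (f ∪ₗ p) Z                          ≡⟨ count-∪-list f (enters Z) p (edges-unique uniq) disjoint ⟩
      ϱ f Z + sumAlong (χ ∘ enters Z) p     ≡⟨ cong₂ _+_ (balance Z Zr) (root-chain-crossings Z Zr chain) ⟩
      δ f Z + χ (Z v) * k + (O + χ (Z v))    ≡⟨ path-arith (δ f Z) O (χ (Z v)) k ⟩
      δ f Z + O + χ (Z v) * suc k
        ≡⟨ cong (_+ χ (Z v) * suc k) (count-∪-list f (leaves Z) p (edges-unique uniq) disjoint) ⟨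
      δ (f ∪ₗ p) Z + χ (Z v) * suc k         ∎
      where
      open ≡-Reasoning
      O = sumAlong (χ ∘ leaves Z) p

  remove-path : ∀ {S v k f} p → Flow S v (suc k) f → Chain D root p v → Unique p → (∀ e → e ∈ p → f e ≡ true) →
    Flow S v k (f ∖ₗ p)
  remove-path {S} {v} {k} {f} p (flow ⊆S balance) chain uniq p⊆f =
    flow (λ e e∈ → ⊆S e (∧-conicalˡ _ _ e∈)) balance′
    where
    balance′ : ∀ Z → Z root ≡ false → ϱ (f ∖ₗ p) Z ≡ δ (f ∖ₗ p) Z + χ (Z v) * k
    balance′ Z Zr = +-cancelʳ-≡ I _ _ (begin
      ϱ (f ∖ₗ p) Z + I                       ≡⟨ count-∖-list f (enters Z) p uniq p⊆f ⟨
      ϱ f Z                                   ≡⟨ balance Z Zr ⟩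
      δ f Z + χ (Z v) * suc k                 ≡⟨ cong (_+ χ (Z v) * suc k) (count-∖-list f (leaves Z) p uniq p⊆f) ⟩
      δ (f ∖ₗ p) Z + O + χ (Z v) * suc k      ≡⟨ path-arith (δ (f ∖ₗ p) Z) O (χ (Z v)) k ⟨
      δ (f ∖ₗ p) Z + χ (Z v) * k + (O + χ (Z v))
        ≡⟨ cong (δ (f ∖ₗ p) Z + χ (Z v) * k +_) (root-chain-crossings Z Zr chain) ⟨
      δ (f ∖ₗ p) Z + χ (Z v) * k + I          ∎)
      where
      open ≡-Reasoning
      I = sumAlong (χ ∘ enters Z) p
      O = sumAlong (χ ∘ leaves Z) p

  ⋃ : ∀ {k} → (Fin k → List (Fin m)) → EdgeSet
  ⋃ P e = anyᶠ λ i → e ∈ᵇ P i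

  ⋃-⊆ : ∀ {S v k P} → DisjointPaths S v k P → ⋃ P ⊆ᵉ S
  ⋃-⊆ {P = P} (paths , _) e e∈ =
    let (i , e∈Pi) = anyᶠ-witness _ e∈ in proj₁ (paths i) e (∈ᵇ⇒∈ (P i) e∈Pi)

  disjointPaths⇒flow : ∀ {S v} k P → DisjointPaths S v k P → Flow S v k (⋃ P)
  disjointPaths⇒flow zero P _ = empty-flow _ _
  disjointPaths⇒flow (suc k) P (paths , disjoint) =
    flow-cong (λ e → ∨-comm (⋃ (P ∘ suc) e) (e ∈ᵇ P zero))
      (add-path (P zero) (disjointPaths⇒flow k (P ∘ suc) (paths ∘ suc , disjoint-tail)) (paths zero) first-fresh)
    where
    disjoint-tail : ∀ i j → i ≢ j → EdgeDisjoint D (P (suc i)) (P (suc j))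
    disjoint-tail i j i≢j = disjoint (suc i) (suc j) (i≢j ∘ suc-injective)
    first-fresh : ∀ e → e ∈ P zero → ⋃ (P ∘ suc) e ≡ false
    first-fresh e e∈ = anyᶠ-false-intro _ λ i → ∉⇒∈ᵇfalse (P (suc i)) (disjoint zero (suc i) (λ ()) e e∈)

  module ReverseSearch (f : EdgeSet) (v : Fin n) = Reachability hd tl f anyᶠ anyᶠ-witness anyᶠ-intro v

  backward-chain : ∀ {a L b} → Walks.RevChain hd tl a L b → Chain D b L a
  backward-chain {L = []} b≡a = b≡a
  backward-chain {L = e ∷ L} (tl≡b , chain) = tl≡b , backward-chain chain

  ϱ-backward-closed : ∀ f v (R : VertexSet) → ReverseSearch.Closed f v R → ϱ f R ≡ 0
  ϱ-backward-closed f v R closed = trans (count-cong none) (count-false {m})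
    where
    none : ∀ e → f e ∧ enters R e ≡ false
    none e with f e in fe | R (hd e) in hd∈
    ... | false | _ = refl
    ... | true | false = ∧-zeroʳ _
    ... | true | true rewrite closed e fe hd∈ = refl

  flow-path : ∀ {S v k f} → Flow S v (suc k) f → Σ (List (Fin m)) (Path f root v)
  flow-path {S} {v} {k} {f} fl =
    let (p , chain , usable , uniq) = R-path root root-reaches-v
    in p , (λ e e∈p → All.lookup usable e∈p) , backward-chain chain , uniq
    where
    open ReverseSearch f v
    open Reach reach
    root-reaches-v : R root ≡ true
    root-reaches-v = ¬-not λ unreached → 0≢1+n (begin
      0                                ≡⟨ ϱ-backward-closed f v R R-closed ⟨
      ϱ f R                            ≡⟨ Flow.balance fl R unreached ⟩
      δ f R + χ (R v) * suc k          ≡⟨ cong (λ b → δ f R + χ b * suc k) R-source ⟩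
      δ f R + (suc k + 0)              ≡⟨ +-suc (δ f R) _ ⟩
      suc (δ f R + (k + 0))            ∎)
      where open ≡-Reasoning

  flow⇒disjointPaths : ∀ {S v} k f → Flow S v k f → Σ (Fin k → List (Fin m)) (DisjointPaths f v k)
  flow⇒disjointPaths zero f _ = (λ ()) , (λ ()) , (λ ())
  flow⇒disjointPaths {S} {v} (suc k) f fl = P , paths , disjoint
    where
    p : List (Fin m)
    p = proj₁ (flow-path fl)
    p-path : Path f root v p
    p-path = proj₂ (flow-path fl)
    rest : Σ (Fin k → List (Fin m)) (DisjointPaths (f ∖ₗ p) v k)
    rest = flow⇒disjointPaths k (f ∖ₗ p)
      (remove-path p fl (proj₁ (proj₂ p-path)) (edges-unique (proj₂ (proj₂ p-path))) (proj₁ p-path))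
    P : Fin (suc k) → List (Fin m)
    P zero = p
    P (suc i) = proj₁ rest i
    paths : ∀ i → Path f root v (P i)
    paths zero = p-path
    paths (suc i) = path-mono (λ e → ∧-conicalˡ (f e) _) (proj₁ (proj₂ rest) i)
    avoids-p : ∀ i e → e ∈ P (suc i) → e ∉ p
    avoids-p i e e∈ e∈p = true≢false (∈⇒∈ᵇ p e∈p)
      (not-injective (∧-conicalʳ (f e) _ (proj₁ (proj₁ (proj₂ rest) i) e e∈)))
    disjoint : ∀ i j → i ≢ j → EdgeDisjoint D (P i) (P j)
    disjoint zero zero i≢j = ⊥-elim (i≢j refl)
    disjoint zero (suc j) _ e e∈p e∈ = avoids-p j e e∈ e∈p
    disjoint (suc i) zero _ e e∈ e∈p = avoids-p i e e∈ e∈p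
    disjoint (suc i) (suc j) i≢j = proj₂ (proj₂ rest) i j (i≢j ∘ cong suc)

  -- Residual arcs: (e , true) runs along e, (e , false) runs against it.
  Arc : Set
  Arc = Fin m × Bool

  arcSrc : Arc → Fin n
  arcSrc (e , true) = tl e
  arcSrc (e , false) = hd e

  arcDst : Arc → Fin n
  arcDst (e , true) = hd e
  arcDst (e , false) = tl e

  residual : EdgeSet → EdgeSet → Arc → Bool
  residual S f (e , true) = S e ∧ not (f e)
  residual S f (e , false) = f e

  anyArc : (Arc → Bool) → Bool
  anyArc P = anyᶠ λ e → P (e , true) ∨ P (e , false)

  anyArc-witness : ∀ P → anyArc P ≡ true → Σ Arc λ α → P α ≡ true
  anyArc-witness P any with anyᶠ-witness _ any
  ... | e , hit with P (e , true) in along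
  ... | true = (e , true) , along
  ... | false = (e , false) , hit

  anyArc-intro : ∀ P α → P α ≡ true → anyArc P ≡ true
  anyArc-intro P (e , true) Pα = anyᶠ-intro _ e (cong (_∨ P (e , false)) Pα)
  anyArc-intro P (e , false) Pα = anyᶠ-intro _ e (trans (cong (P (e , true) ∨_) Pα) (∨-zeroʳ (P (e , true))))

  module Residual (S f : EdgeSet) = Reachability arcSrc arcDst (residual S f) anyArc anyArc-witness anyArc-intro root

  forwardEdges : List Arc → List (Fin m)
  forwardEdges [] = []
  forwardEdges ((e , true) ∷ L) = e ∷ forwardEdges L
  forwardEdges ((e , false) ∷ L) = forwardEdges L

  backwardEdges : List Arc → List (Fin m)
  backwardEdges [] = []
  backwardEdges ((e , true) ∷ L) = backwardEdges L
  backwardEdges ((e , false) ∷ L) = e ∷ backwardEdges L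

  forwardEdges-src : ∀ {e} L → e ∈ forwardEdges L → tl e ∈ map arcSrc L
  forwardEdges-src ((x , true) ∷ L) (here refl) = here refl
  forwardEdges-src ((x , true) ∷ L) (there e∈) = there (forwardEdges-src L e∈)
  forwardEdges-src ((x , false) ∷ L) e∈ = there (forwardEdges-src L e∈)

  backwardEdges-src : ∀ {e} L → e ∈ backwardEdges L → hd e ∈ map arcSrc L
  backwardEdges-src ((x , false) ∷ L) (here refl) = here refl
  backwardEdges-src ((x , false) ∷ L) (there e∈) = there (backwardEdges-src L e∈)
  backwardEdges-src ((x , true) ∷ L) e∈ = there (backwardEdges-src L e∈)

  forwardEdges-unique : ∀ L → Unique (map arcSrc L) → Unique (forwardEdges L)
  forwardEdges-unique [] _ = []
  forwardEdges-unique ((e , true) ∷ L) (fresh ∷ uniq) =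
    ¬Any⇒All¬ _ (λ e∈ → All.lookup fresh (forwardEdges-src L e∈) refl) ∷ forwardEdges-unique L uniq
  forwardEdges-unique ((e , false) ∷ L) (_ ∷ uniq) = forwardEdges-unique L uniq

  backwardEdges-unique : ∀ L → Unique (map arcSrc L) → Unique (backwardEdges L)
  backwardEdges-unique [] _ = []
  backwardEdges-unique ((e , false) ∷ L) (fresh ∷ uniq) =
    ¬Any⇒All¬ _ (λ e∈ → All.lookup fresh (backwardEdges-src L e∈) refl) ∷ backwardEdges-unique L uniq
  backwardEdges-unique ((e , true) ∷ L) (_ ∷ uniq) = backwardEdges-unique L uniq

  forwardEdges-residual : ∀ {S f e} L → All (λ α → residual S f α ≡ true) L → e ∈ forwardEdges L →
    S e ≡ true × f e ≡ false
  forwardEdges-residual {S} ((x , true) ∷ L) (ok ∷ _) (here refl) =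
    ∧-conicalˡ (S x) _ ok , not-injective (∧-conicalʳ (S x) _ ok)
  forwardEdges-residual ((x , true) ∷ L) (_ ∷ ok) (there e∈) = forwardEdges-residual L ok e∈
  forwardEdges-residual ((x , false) ∷ L) (_ ∷ ok) e∈ = forwardEdges-residual L ok e∈

  backwardEdges-residual : ∀ {S f e} L → All (λ α → residual S f α ≡ true) L → e ∈ backwardEdges L → f e ≡ true
  backwardEdges-residual ((x , false) ∷ L) (ok ∷ _) (here refl) = ok
  backwardEdges-residual ((x , false) ∷ L) (_ ∷ ok) (there e∈) = backwardEdges-residual L ok e∈
  backwardEdges-residual ((x , true) ∷ L) (_ ∷ ok) e∈ = backwardEdges-residual L ok e∈

  module ResidualWalk = Walks arcSrc arcDst

  arcEnters-split : (Z : VertexSet) → ∀ L → sumAlong (χ ∘ ResidualWalk.arcEnters Z) L ≡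
    sumAlong (χ ∘ enters Z) (forwardEdges L) + sumAlong (χ ∘ leaves Z) (backwardEdges L)
  arcEnters-split Z [] = refl
  arcEnters-split Z ((e , true) ∷ L) rewrite arcEnters-split Z L = sym (+-assoc (χ (enters Z e)) _ _)
  arcEnters-split Z ((e , false) ∷ L) rewrite arcEnters-split Z L | ∧-comm (not (Z (hd e))) (Z (tl e)) =
    x∙yz≈y∙xz (χ (leaves Z e)) (sumAlong (χ ∘ enters Z) (forwardEdges L)) (sumAlong (χ ∘ leaves Z) (backwardEdges L))

  arcLeaves-split : (Z : VertexSet) → ∀ L → sumAlong (χ ∘ ResidualWalk.arcLeaves Z) L ≡
    sumAlong (χ ∘ leaves Z) (forwardEdges L) + sumAlong (χ ∘ enters Z) (backwardEdges L)
  arcLeaves-split Z [] = refl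
  arcLeaves-split Z ((e , true) ∷ L) rewrite arcLeaves-split Z L = sym (+-assoc (χ (leaves Z e)) _ _)
  arcLeaves-split Z ((e , false) ∷ L) rewrite arcLeaves-split Z L | ∧-comm (Z (hd e)) (not (Z (tl e))) =
    x∙yz≈y∙xz (χ (enters Z e)) (sumAlong (χ ∘ leaves Z) (forwardEdges L)) (sumAlong (χ ∘ enters Z) (backwardEdges L))

  residual-path-crossings : (Z : VertexSet) → Z root ≡ false → ∀ {L v} → ResidualWalk.RevChain root L v →
    sumAlong (χ ∘ enters Z) (forwardEdges L) + sumAlong (χ ∘ leaves Z) (backwardEdges L) ≡
    sumAlong (χ ∘ leaves Z) (forwardEdges L) + sumAlong (χ ∘ enters Z) (backwardEdges L) + χ (Z v)
  residual-path-crossings Z Zr {L} {v} chain = begin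
    sumAlong (χ ∘ enters Z) (forwardEdges L) + sumAlong (χ ∘ leaves Z) (backwardEdges L)  ≡⟨ arcEnters-split Z L ⟨
    E                                            ≡⟨ +-identityʳ E ⟨
    E + 0                                        ≡⟨ cong (λ b → E + χ b) Zr ⟨
    E + χ (Z root)                               ≡⟨ ResidualWalk.revChain-crossings Z chain ⟩
    sumAlong (χ ∘ ResidualWalk.arcLeaves Z) L + χ (Z v)  ≡⟨ cong (_+ χ (Z v)) (arcLeaves-split Z L) ⟩
    sumAlong (χ ∘ leaves Z) (forwardEdges L) + sumAlong (χ ∘ enters Z) (backwardEdges L) + χ (Z v)  ∎
    where
    open ≡-Reasoning
    E = sumAlong (χ ∘ ResidualWalk.arcEnters Z) L

  augment-arith : ∀ ϱ₀ δ₀ Fi Fo Bi Bo z k → ϱ₀ + Bi ≡ δ₀ + Bo + z * k → Fi + Bo ≡ Fo + Bi + z →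
    ϱ₀ + Fi ≡ δ₀ + Fo + z * suc k
  augment-arith ϱ₀ δ₀ Fi Fo Bi Bo z k old path = +-cancelʳ-≡ (Bi + Bo) _ _ (begin
    ϱ₀ + Fi + (Bi + Bo)                   ≡⟨ regroup ϱ₀ Fi Bi Bo ⟩
    (ϱ₀ + Bi) + (Fi + Bo)                 ≡⟨ cong₂ _+_ old path ⟩
    (δ₀ + Bo + z * k) + (Fo + Bi + z)     ≡⟨ regroup′ δ₀ Fo Bi Bo z k ⟩
    δ₀ + Fo + z * suc k + (Bi + Bo)       ∎)
    where
    open ≡-Reasoning
    regroup : ∀ a b c d → a + b + (c + d) ≡ (a + c) + (b + d)
    regroup = solve-∀
    regroup′ : ∀ a b c d z k → (a + d + z * k) + (b + c + z) ≡ a + b + z * suc k + (c + d)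
    regroup′ = solve-∀

  rerouted : EdgeSet → List Arc → EdgeSet
  rerouted f L = (f ∖ₗ backwardEdges L) ∪ₗ forwardEdges L

  reroute-flow : ∀ {S v k f} → Flow S v k f → (P : Residual.RevPath S f v) → Flow S v (suc k) (rerouted f (proj₁ P))
  reroute-flow {S} {v} {k} {f} (flow ⊆S balance) (L , chain , usable , _ ∷ uniq) = flow ⊆S′ balance′
    where
    Fw = forwardEdges L
    Bw = backwardEdges L
    f₀ : EdgeSet
    f₀ = f ∖ₗ Bw
    ⊆S′ : rerouted f L ⊆ᵉ S
    ⊆S′ e e∈ with f e in fe | e ∈ᵇ Fw in e∈Fw
    ... | true | _ = ⊆S e fe
    ... | false | true = proj₁ (forwardEdges-residual L usable (∈ᵇ⇒∈ Fw e∈Fw))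
    Fw-fresh : ∀ e → e ∈ Fw → f₀ e ≡ false
    Fw-fresh e e∈ rewrite proj₂ (forwardEdges-residual L usable e∈) = refl
    Bw⊆f : ∀ e → e ∈ Bw → f e ≡ true
    Bw⊆f e = backwardEdges-residual L usable
    Fw-unique = forwardEdges-unique L uniq
    Bw-unique = backwardEdges-unique L uniq
    balance′ : ∀ Z → Z root ≡ false → ϱ (rerouted f L) Z ≡ δ (rerouted f L) Z + χ (Z v) * suc k
    balance′ Z Zr = begin
      ϱ (rerouted f L) Z            ≡⟨ count-∪-list f₀ (enters Z) Fw Fw-unique Fw-fresh ⟩
      ϱ f₀ Z + Fi                   ≡⟨ augment-arith (ϱ f₀ Z) (δ f₀ Z) Fi Fo Bi Bo (χ (Z v)) k old
                                         (residual-path-crossings Z Zr chain) ⟩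
      δ f₀ Z + Fo + χ (Z v) * suc k ≡⟨ cong (_+ χ (Z v) * suc k) (count-∪-list f₀ (leaves Z) Fw Fw-unique Fw-fresh) ⟨
      δ (rerouted f L) Z + χ (Z v) * suc k ∎
      where
      open ≡-Reasoning
      Fi = sumAlong (χ ∘ enters Z) Fw
      Fo = sumAlong (χ ∘ leaves Z) Fw
      Bi = sumAlong (χ ∘ enters Z) Bw
      Bo = sumAlong (χ ∘ leaves Z) Bw
      old : ϱ f₀ Z + Bi ≡ δ f₀ Z + Bo + χ (Z v) * k
      old = begin
        ϱ f₀ Z + Bi               ≡⟨ count-∖-list f (enters Z) Bw Bw-unique Bw⊆f ⟨
        ϱ f Z                     ≡⟨ balance Z Zr ⟩
        δ f Z + χ (Z v) * k       ≡⟨ cong (_+ χ (Z v) * k) (count-∖-list f (leaves Z) Bw Bw-unique Bw⊆f) ⟩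
        δ f₀ Z + Bo + χ (Z v) * k ∎

  -- A simple residual path never returns to v, so it uses no edge into v backwards.
  reroute-keeps-into : ∀ {S f v} (P : Residual.RevPath S f v) →
    ∀ e → f e ≡ true → hd e ≡ v → rerouted f (proj₁ P) e ≡ true
  reroute-keeps-into {f = f} (L , _ , _ , v-fresh ∷ _) e fe hd≡v with e ∈ᵇ backwardEdges L in e∈Bw
  ... | true = ⊥-elim (All.lookup v-fresh (backwardEdges-src L (∈ᵇ⇒∈ (backwardEdges L) e∈Bw)) (sym hd≡v))
  ... | false rewrite fe = refl

  reachable : EdgeSet → EdgeSet → VertexSet
  reachable S f = Reach.R reach
    where open Residual S f

  record Augmentation (S : EdgeSet) (v : Fin n) (k : ℕ) (f : EdgeSet) : Set where
    field
      larger : EdgeSet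
      larger-flow : Flow S v (suc k) larger
      keeps-into-v : ∀ e → f e ≡ true → hd e ≡ v → larger e ≡ true

  augment : ∀ {S v k f} → Flow S v k f → Augmentation S v k f ⊎ reachable S f v ≡ false
  augment {S} {v} {k} {f} fl with reachable S f v in v-reached
  ... | false = inj₂ refl
  ... | true = inj₁ record
    { larger = rerouted f (proj₁ P) ; larger-flow = reroute-flow fl P ; keeps-into-v = reroute-keeps-into P }
    where P = Residual.Reach.R-path (Residual.reach S f) v v-reached

  flow-value≤m : ∀ {S v k f} → Flow S v k f → v ≢ root → k ≤ m
  flow-value≤m {S} {v} {k} {f} fl v≢r = begin
    k                          ≡⟨ +-identityʳ k ⟨
    χ true * k                 ≡⟨ cong (λ b → χ b * k) (==-refl v) ⟨
    χ (Z v) * k                ≤⟨ m≤n+m _ (δ f Z) ⟩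
    δ f Z + χ (Z v) * k        ≡⟨ Flow.balance fl Z (≢⇒==false (v≢r ∘ sym)) ⟨
    ϱ f Z                      ≤⟨ count≤size _ ⟩
    m                          ∎
    where
    open ≤-Reasoning
    Z : VertexSet
    Z u = u == v

  record MaximumFlow (S : EdgeSet) (v : Fin n) : Set where
    field
      value : ℕ
      edges : EdgeSet
      is-flow : Flow S v value edges
      saturated : reachable S edges v ≡ false

  -- Each augmentation raises the value, which is bounded by m, so m + 1 rounds suffice.
  augment-until-saturated : ∀ {S v} rounds k f → Flow S v k f → v ≢ root → m < k + rounds → MaximumFlow S v
  augment-until-saturated zero k f fl v≢r m<k = ⊥-elim (<⇒≱ (subst (m <_) (+-identityʳ k) m<k) (flow-value≤m fl v≢r))
  augment-until-saturated (suc rounds) k f fl v≢r m<k+r with augment fl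
  ... | inj₁ aug = augment-until-saturated rounds (suc k) _ (Augmentation.larger-flow aug) v≢r (subst (m <_) (+-suc k rounds) m<k+r)
  ... | inj₂ saturated = record { value = k ; edges = f ; is-flow = fl ; saturated = saturated }

  maximumFlow : ∀ S v → v ≢ root → MaximumFlow S v
  maximumFlow S v v≢r = augment-until-saturated (suc m) 0 (λ _ → false) (empty-flow S v) v≢r ≤-refl

  module SaturatedCut {S v k f} (fl : Flow S v k f) (saturated : reachable S f v ≡ false) where
    open Residual S f
    open Reach reach

    cut : VertexSet
    cut u = not (R u)

    cut-root : cut root ≡ false
    cut-root = cong not R-source

    cut-v : cut v ≡ true
    cut-v = cong not saturated

    entering-S⇒f : ∀ e → S e ≡ true → enters cut e ≡ true → f e ≡ true
    entering-S⇒f e Se enters-e = ¬-not λ fe → true≢false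
      (R-closed (e , true) (cong₂ _∧_ Se (cong not fe)) (not-injective (not-injective (∧-conicalˡ _ _ enters-e))))
      (not-injective (∧-conicalʳ (not (cut (tl e))) _ enters-e))

    f⇒¬leaves : ∀ e → f e ≡ true → leaves cut e ≡ false
    f⇒¬leaves e fe with R (hd e) in hd-reached
    ... | false = ∧-zeroʳ _
    ... | true rewrite R-closed (e , false) fe hd-reached = refl

    δ≡0 : δ f cut ≡ 0
    δ≡0 = trans (count-cong none) (count-false {m})
      where
      none : ∀ e → f e ∧ leaves cut e ≡ false
      none e with f e in fe
      ... | false = refl
      ... | true = f⇒¬leaves e fe

    ϱf≡value : ϱ f cut ≡ k
    ϱf≡value = begin
      ϱ f cut                      ≡⟨ Flow.balance fl cut cut-root ⟩
      δ f cut + χ (cut v) * k      ≡⟨ cong₂ (λ d b → d + χ b * k) δ≡0 cut-v ⟩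
      k + 0                        ≡⟨ +-identityʳ k ⟩
      k                            ∎
      where open ≡-Reasoning

    ϱS≡value : ϱ S cut ≡ k
    ϱS≡value = trans (count-cong same) ϱf≡value
      where
      same : ∀ e → S e ∧ enters cut e ≡ f e ∧ enters cut e
      same e with f e in fe | S e in Se
      ... | true | true = refl
      ... | true | false = ⊥-elim (true≢false (Flow.⊆S fl e fe) Se)
      ... | false | false = refl
      ... | false | true with enters cut e in enters-e
      ...   | true = ⊥-elim (true≢false (entering-S⇒f e Se enters-e) fe)
      ...   | false = refl

  chain-enters : (Z : VertexSet) → ∀ {a p b} → Chain D a p b → Z a ≡ false → Z b ≡ true →
    Σ (Fin m) λ e → e ∈ p × enters Z e ≡ true
  chain-enters Z {p = []} refl Za Zb = ⊥-elim (true≢false Zb Za)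
  chain-enters Z {p = e ∷ p} (refl , chain) Za Zb with Z (hd e) in Zhd
  ... | true = e , here refl , cong₂ _∧_ (cong not Za) Zhd
  ... | false = let (x , x∈ , enters-x) = chain-enters Z chain Zhd Zb in x , there x∈ , enters-x

  module CrossingEdges {S v k P} (paths : DisjointPaths S v k P) (Z : VertexSet) (Zr : Z root ≡ false) (Zv : Z v ≡ true) where

    crossing : ∀ i → Σ (Fin m) λ e → e ∈ P i × enters Z e ≡ true
    crossing i = chain-enters Z (proj₁ (proj₂ (proj₁ paths i))) Zr Zv

    crossingEdge : Fin k → Fin m
    crossingEdge = proj₁ ∘ crossing

    crossingEdge-enters : ∀ i → enters Z (crossingEdge i) ≡ true
    crossingEdge-enters = proj₂ ∘ proj₂ ∘ crossing

    crossingEdge-∈ : ∀ i → S (crossingEdge i) ≡ true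
    crossingEdge-∈ i = proj₁ (proj₁ paths i) _ (proj₁ (proj₂ (crossing i)))

    crossingEdge-injective : Injective _≡_ _≡_ crossingEdge
    crossingEdge-injective {i} {j} same with i ≟ j
    ... | yes i≡j = i≡j
    ... | no i≢j = ⊥-elim (proj₂ paths i j i≢j _ (proj₁ (proj₂ (crossing i)))
                     (subst (_∈ P j) (sym same) (proj₁ (proj₂ (crossing j)))))

  disjointPaths≤ϱ : ∀ {S v k P} → DisjointPaths S v k P → (Z : VertexSet) → Z root ≡ false → Z v ≡ true → k ≤ ϱ S Z
  disjointPaths≤ϱ paths Z Zr Zv = injection⇒≤count crossingEdge crossingEdge-injective _
    λ i → cong₂ _∧_ (crossingEdge-∈ i) (crossingEdge-enters i)
    where open CrossingEdges paths Z Zr Zv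

  enters-submodular : ∀ z₁ z₂ w₁ w₂ →
    χ (not (z₁ ∨ w₁) ∧ (z₂ ∨ w₂)) + χ (not (z₁ ∧ w₁) ∧ (z₂ ∧ w₂)) ≤
    χ (not z₁ ∧ z₂) + χ (not w₁ ∧ w₂)
  enters-submodular true z₂ true w₂ = z≤n
  enters-submodular true z₂ false w₂ = χ-mono (∧-conicalʳ z₂ w₂)
  enters-submodular false z₂ true w₂ = ≤-trans (χ-mono (∧-conicalˡ z₂ w₂)) (m≤m+n (χ z₂) 0)
  enters-submodular false true false w₂ = ≤-refl
  enters-submodular false false false w₂ = ≤-reflexive (+-identityʳ (χ w₂))

  _∪ᵛ_ : VertexSet → VertexSet → VertexSet
  (Z ∪ᵛ W) u = Z u ∨ W u

  _∩ᵛ_ : VertexSet → VertexSet → VertexSet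
  (Z ∩ᵛ W) u = Z u ∧ W u

  ϱ-submodular : ∀ S Z W → ϱ S (Z ∪ᵛ W) + ϱ S (Z ∩ᵛ W) ≤ ϱ S Z + ϱ S W
  ϱ-submodular S Z W = begin
    ϱ S (Z ∪ᵛ W) + ϱ S (Z ∩ᵛ W)   ≡⟨ ∑-distrib-+ (χ ∘ entersIn (Z ∪ᵛ W)) (χ ∘ entersIn (Z ∩ᵛ W)) ⟨
    sum (λ e → χ (entersIn (Z ∪ᵛ W) e) + χ (entersIn (Z ∩ᵛ W) e))  ≤⟨ sum-mono-≤ per-edge ⟩
    sum (λ e → χ (entersIn Z e) + χ (entersIn W e))  ≡⟨ ∑-distrib-+ (χ ∘ entersIn Z) (χ ∘ entersIn W) ⟩
    ϱ S Z + ϱ S W                 ∎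
    where
    open ≤-Reasoning
    entersIn : VertexSet → Fin m → Bool
    entersIn Y e = S e ∧ enters Y e
    per-edge : ∀ e → χ (entersIn (Z ∪ᵛ W) e) + χ (entersIn (Z ∩ᵛ W) e) ≤ χ (entersIn Z e) + χ (entersIn W e)
    per-edge e with S e
    ... | true = enters-submodular (Z (tl e)) (Z (hd e)) (W (tl e)) (W (hd e))
    ... | false = z≤n

  -- A cut no larger than the flow value is saturated: every S-edge entering it carries flow
  -- and no flow edge leaves it, so no residual arc enters it.
  tight-cut-unreachable : ∀ {S v k f} → Flow S v k f → (Z : VertexSet) → Z root ≡ false → Z v ≡ true →
    ϱ S Z ≤ k → ∀ u → Z u ≡ true → reachable S f u ≡ false
  tight-cut-unreachable {S} {v} {k} {f} fl Z Zr Zv ϱS≤k u Zu = ¬-not λ u-reached →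
    let (L , chain , usable , _) = R-path u u-reached
        (α , α∈L , enters-α) = revChain-enters Z chain Zr Zu
    in no-arc-enters α (All.lookup usable α∈L) enters-α
    where
    open Residual S f
    open Reach reach
    balance : ϱ f Z ≡ δ f Z + k
    balance = begin
      ϱ f Z                  ≡⟨ Flow.balance fl Z Zr ⟩
      δ f Z + χ (Z v) * k    ≡⟨ cong (λ b → δ f Z + χ b * k) Zv ⟩
      δ f Z + (k + 0)        ≡⟨ cong (δ f Z +_) (+-identityʳ k) ⟩
      δ f Z + k              ∎
      where open ≡-Reasoning
    f-enters≤S-enters : ∀ e → χ (f e ∧ enters Z e) ≤ χ (S e ∧ enters Z e)
    f-enters≤S-enters e = χ-mono λ both → cong₂ _∧_ (Flow.⊆S fl e (∧-conicalˡ _ _ both)) (∧-conicalʳ (f e) _ both)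
    ϱS≤ϱf : ϱ S Z ≤ ϱ f Z
    ϱS≤ϱf = ≤-trans ϱS≤k (≤-trans (m≤n+m k (δ f Z)) (≤-reflexive (sym balance)))
    δ≡0 : δ f Z ≡ 0
    δ≡0 = n≤0⇒n≡0 (+-cancelʳ-≤ k (δ f Z) 0
            (≤-trans (≤-reflexive (sym balance)) (≤-trans (sum-mono-≤ f-enters≤S-enters) ϱS≤k)))
    entering-S⇒f : ∀ e → S e ≡ true → enters Z e ≡ true → f e ≡ true
    entering-S⇒f e Se enters-e = ∧-conicalˡ (f e) _ (χ≡1⇒true
      (trans (sum-mono-≤-rigid f-enters≤S-enters ϱS≤ϱf e) (cong χ (cong₂ _∧_ Se enters-e))))
    f⇒¬leaves : ∀ e → f e ≡ true → leaves Z e ≡ false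
    f⇒¬leaves e fe = ¬-not λ leaves-e → 0≢1+n (sym (trans (cong χ (sym (cong₂ _∧_ fe leaves-e))) (sum≡0⇒≡0 δ≡0 e)))
    no-arc-enters : ∀ α → residual S f α ≡ true → arcEnters Z α ≡ true → Empty
    no-arc-enters (e , true) usable-e enters-e =
      true≢false (entering-S⇒f e (∧-conicalˡ (S e) _ usable-e) enters-e) (not-injective (∧-conicalʳ (S e) _ usable-e))
    no-arc-enters (e , false) fe enters-e =
      true≢false (trans (∧-comm (Z (tl e)) (not (Z (hd e)))) enters-e) (f⇒¬leaves e fe)

  lookup-inEdges : ∀ v e → lookup (inEdges D v) e ≡ (hd e == v)
  lookup-inEdges v = lookup∘tabulate _

  lookup-allEdges : ∀ e → lookup (allEdges D) e ≡ true
  lookup-allEdges = lookup∘tabulate _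

  lookup-edgesMinus : ∀ t e → lookup (edgesMinus D t) e ≡ not (tl e == t) ∧ not (hd e == t)
  lookup-edgesMinus t = lookup∘tabulate _

  indeg≡count : ∀ F v → indeg D F v ≡ count (λ e → lookup F e ∧ (hd e == v))
  indeg≡count F v = trans (∣∣≡count (F ∩ inEdges D v))
    (count-cong λ e → trans (lookup-∩ F (inEdges D v) e) (cong (lookup F e ∧_) (lookup-inEdges v e)))

  toDisjointPaths : ∀ {S v k P} → DisjPaths D S root v k P → DisjointPaths (lookup S) v k P
  toDisjointPaths (paths , disjoint) =
    (λ i → let (p⊆S , chain , uniq) = paths i
           in (λ e e∈p → ∈⇒lookup (All.lookup p⊆S e∈p)) , chain , uniq) , disjoint

  fromDisjointPaths : ∀ {S v k P} → DisjointPaths (lookup S) v k P → DisjPaths D S root v k P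
  fromDisjointPaths (paths , disjoint) =
    (λ i → let (p⊆S , chain , uniq) = paths i
           in All.tabulate (λ {e} e∈p → lookup⇒∈ (p⊆S e e∈p)) , chain , uniq) , disjoint

  isLambda : ∀ {S v k P} → DisjointPaths (lookup S) v k P →
    (∀ {j Q} → DisjointPaths (lookup S) v j Q → j ≤ k) → IsLambda D S v k
  isLambda paths bound = (_ , fromDisjointPaths paths) , λ _ (_ , paths′) → bound (toDisjointPaths paths′)

  lambda-paths : ∀ {S v k} → IsLambda D S v k → Σ (Fin k → List (Fin m)) (DisjointPaths (lookup S) v k)
  lambda-paths ((P , paths) , _) = P , toDisjointPaths paths

  lambda-bound : ∀ {S v k j P} → IsLambda D S v k → DisjointPaths (lookup S) v j P → j ≤ k
  lambda-bound (_ , maximal) paths = maximal _ (_ , fromDisjointPaths paths)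

  IsLambda-cong : ∀ {S S′ v k} →
    (∀ {p} → Path (lookup S) root v p → Path (lookup S′) root v p) →
    (∀ {p} → Path (lookup S′) root v p → Path (lookup S) root v p) →
    IsLambda D S v k → IsLambda D S′ v k
  IsLambda-cong S⇒S′ S′⇒S λS =
    isLambda (move S⇒S′ (proj₂ (lambda-paths λS))) (lambda-bound λS ∘ move S′⇒S)
    where
    move : ∀ {A B v k P} → (∀ {p} → Path A root v p → Path B root v p) → DisjointPaths A v k P → DisjointPaths B v k P
    move A⇒B (paths , disjoint) = (λ i → A⇒B (paths i)) , disjoint

module SinkSplitting (D : RootedDigraph) (t : Fin (RootedDigraph.n D))
  (t≢root : t ≢ RootedDigraph.root D) (sink : IsSink D t) where
  open import Data.Fin using (Fin; _≟_)
  open import Relation.Binary.PropositionalEquality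
  open import Data.Nat using (suc; _+_; _*_; _≤_; _<_; _≤?_; s≤s)
  open import Data.Nat.Properties
    using (module ≤-Reasoning; ≤-refl; ≤-trans; ≤-reflexive; <⇒≱; ≰⇒>; +-cancelʳ-≤; +-monoʳ-≤; +-identityʳ)
  open import Data.Bool using (true; false; _∧_; _∨_; not)
  open import Data.Bool.Properties
    using (∧-conicalˡ; ∧-conicalʳ; ∧-identityʳ; ∧-zeroʳ; ∨-zeroʳ; ∨-identityʳ; not-injective; ¬-not)
  open import Data.Fin.Subset using (Subset; _∈_; _⊆_; ∣_∣; _∩_; _∪_; ∁; ⊥)
  open import Data.Fin.Subset.Properties using (p⊆q⇒∣p∣≤∣q∣)
  open import Data.Vec using (lookup; tabulate)
  open import Data.Vec.Properties using (lookup∘tabulate)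
  open import Data.List using (List; []; _∷_; last)
  open import Data.List.Membership.Propositional renaming (_∈_ to _∈ₗ_)
  open import Data.List.Relation.Unary.Any using (here; there)
  open import Data.Maybe using (just)
  open import Data.Maybe.Properties using (just-injective)
  open import Data.Product using (Σ; ∃; _×_; _,_; proj₁; proj₂)
  open import Data.Sum using ([_,_]′)
  open import Data.Empty using (⊥-elim) renaming (⊥ to Empty)
  open import Data.Unit using (tt)
  open import Function using (_∘_)
  open import Function.Definitions using (Injective)
  open import Relation.Nullary using (Dec; yes; no)
  open Counting
  open SubsetLookup
  open Flows D
  open RootedDigraph D

  D∖t : EdgeSet
  D∖t = lookup (edgesMinus D t)

  hd≢t⇒D∖t : ∀ e → hd e ≢ t → D∖t e ≡ true
  hd≢t⇒D∖t e hd≢t rewrite lookup-edgesMinus t e | ≢⇒==false (sink e) | ≢⇒==false hd≢t = refl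

  D∖t⇒hd≢t : ∀ e → D∖t e ≡ true → hd e ≢ t
  D∖t⇒hd≢t e e∈ hd≡t rewrite lookup-edgesMinus t e | hd≡t | ==-refl t =
    true≢false (∧-conicalʳ (not (tl e == t)) _ e∈) refl

  chain-misses-t : ∀ {a p v} → Chain D a p v → v ≢ t → ∀ e → e ∈ₗ p → hd e ≢ t
  chain-misses-t {p = e ∷ []} (_ , refl) v≢t e (here refl) = v≢t
  chain-misses-t {p = e ∷ e′ ∷ p} (_ , tl≡ , _) v≢t e (here refl) hd≡t = sink e′ (trans tl≡ hd≡t)
  chain-misses-t {p = e′ ∷ p} (_ , chain) v≢t e (there e∈) = chain-misses-t chain v≢t e e∈

  chain-to-t-ends : ∀ {a p} → Chain D a p t → ∀ e → e ∈ₗ p → hd e ≡ t → last p ≡ just e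
  chain-to-t-ends {p = e ∷ []} _ e (here refl) _ = refl
  chain-to-t-ends {p = e ∷ e′ ∷ p} (_ , tl≡ , _) e (here refl) hd≡t = ⊥-elim (sink e′ (trans tl≡ hd≡t))
  chain-to-t-ends {p = e′ ∷ e″ ∷ p} (_ , chain) e (there e∈) hd≡t = chain-to-t-ends chain e e∈ hd≡t

  -- Edge sets agreeing off in(t) look alike from every v ≠ t: as t is a sink, no path to v
  -- uses an edge into t.
  record _≈ₜ_ (A B : Subset m) : Set where
    constructor agree-off-t
    field agree : ∀ e → hd e ≢ t → lookup A e ≡ lookup B e
  open _≈ₜ_

  ≈ₜ-sym : ∀ {A B} → A ≈ₜ B → B ≈ₜ A
  ≈ₜ-sym A≈B = agree-off-t λ e hd≢t → sym (agree A≈B e hd≢t)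

  path-transfer : ∀ {A B} → A ≈ₜ B → ∀ {v} → v ≢ t → ∀ {p} → Path (lookup A) root v p → Path (lookup B) root v p
  path-transfer A≈B v≢t (p⊆A , chain , uniq) =
    (λ e e∈p → trans (sym (agree A≈B e (chain-misses-t chain v≢t e e∈p))) (p⊆A e e∈p)) , chain , uniq

  indeg-transfer : ∀ {A B} → A ≈ₜ B → ∀ {v} → v ≢ t → indeg D A v ≡ indeg D B v
  indeg-transfer {A} {B} A≈B {v} v≢t = trans (indeg≡count A v) (trans (count-cong same) (sym (indeg≡count B v)))
    where
    same : ∀ e → lookup A e ∧ (hd e == v) ≡ lookup B e ∧ (hd e == v)
    same e with hd e == v in hd≡v
    ... | false = trans (∧-zeroʳ _) (sym (∧-zeroʳ _))
    ... | true = cong (_∧ true) (agree A≈B e λ hd≡t → v≢t (trans (sym (==⇒≡ hd≡v)) hd≡t))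

  FlameAt : Subset m → Subset m → Fin n → Set
  FlameAt E F v = IsLambda D E v (indeg D F v) × IsLambda D F v (indeg D F v)

  flameAt-transfer : ∀ {E E′ F F′} → E ≈ₜ E′ → F ≈ₜ F′ → ∀ {v} → v ≢ t → FlameAt E F v → FlameAt E′ F′ v
  flameAt-transfer E≈E′ F≈F′ v≢t (λE , λF) =
    subst (IsLambda D _ _) same-indeg (IsLambda-cong (path-transfer E≈E′ v≢t) (path-transfer (≈ₜ-sym E≈E′) v≢t) λE) ,
    subst (IsLambda D _ _) same-indeg (IsLambda-cong (path-transfer F≈F′ v≢t) (path-transfer (≈ₜ-sym F≈F′) v≢t) λF)
    where same-indeg = indeg-transfer F≈F′ v≢t

  allEdges≈ₜD∖t : allEdges D ≈ₜ edgesMinus D t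
  allEdges≈ₜD∖t = agree-off-t λ e hd≢t → trans (lookup-allEdges e) (sym (hd≢t⇒D∖t e hd≢t))

  module LastEdges {S k P} (paths : DisjointPaths S t k P) where

    final : ∀ i → Σ (Fin m) λ e → last (P i) ≡ just e × e ∈ₗ P i × hd e ≡ t
    final i = chain-last (proj₁ (proj₂ (proj₁ paths i))) (t≢root ∘ sym)

    lastEdge : Fin k → Fin m
    lastEdge = proj₁ ∘ final

    lastEdge-last : ∀ i → last (P i) ≡ just (lastEdge i)
    lastEdge-last = proj₁ ∘ proj₂ ∘ final

    lastEdge-∈ : ∀ i → lastEdge i ∈ₗ P i
    lastEdge-∈ = proj₁ ∘ proj₂ ∘ proj₂ ∘ final

    lastEdge-hd : ∀ i → hd (lastEdge i) ≡ t
    lastEdge-hd = proj₂ ∘ proj₂ ∘ proj₂ ∘ final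

    lastEdge-into-t : ∀ i → S (lastEdge i) ∧ (hd (lastEdge i) == t) ≡ true
    lastEdge-into-t i = cong₂ _∧_ (proj₁ (proj₁ paths i) _ (lastEdge-∈ i)) (≡⇒==true (lastEdge-hd i))

    lastEdge-injective : Injective _≡_ _≡_ lastEdge
    lastEdge-injective {i} {j} same with i ≟ j
    ... | yes i≡j = i≡j
    ... | no i≢j = ⊥-elim (proj₂ paths i j i≢j _ (lastEdge-∈ i) (subst (_∈ₗ P j) (sym same) (lastEdge-∈ j)))

    lastEdge-onto : ∀ {Y : Subset m} → (∀ i → lookup Y (lastEdge i) ≡ true) → ∣ Y ∣ ≤ k →
      ∀ e → e ∈ Y → ∃ λ i → last (P i) ≡ just e
    lastEdge-onto {Y} ends-in-Y ∣Y∣≤k e e∈Y =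
      let (i , last≡e) = injection-onto lastEdge lastEdge-injective (lookup Y) ends-in-Y
                           (subst (_≤ k) (∣∣≡count Y) ∣Y∣≤k) e (∈⇒lookup e∈Y)
      in i , trans (lastEdge-last i) (cong just last≡e)

  -- As many disjoint paths as Y has elements, all ending in Y, must end in every edge of Y.
  independent-by-last-edges : ∀ {S K P} (Y : Subset m) → Y ⊆ inEdges D t → ∣ Y ∣ ≡ K →
    (paths : DisjointPaths S t K P) → (∀ i → lookup Y (LastEdges.lastEdge paths i) ≡ true) → IndepG D t Y
  independent-by-last-edges {P = P} Y Y⊆in refl paths ends-in-Y =
    Y⊆in , P , fromDisjointPaths (disjointPaths-mono (λ e _ → lookup-allEdges e) paths) ,
    lastEdge-onto ends-in-Y ≤-refl , inside
    where
    open LastEdges paths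
    inside : ∀ i e → last (P i) ≡ just e → e ∈ Y
    inside i e last≡e = lookup⇒∈ (subst (λ x → lookup Y x ≡ true)
      (just-injective (trans (sym (lastEdge-last i)) last≡e)) (ends-in-Y i))

  module Splitting (F : Subset m) (flame : MaxFlame D F) where
    F₁ F₂ : Subset m
    F₁ = F ∩ ∁ (inEdges D t)
    F₂ = F ∩ inEdges D t

    lookup-F₁ : ∀ e → lookup F₁ e ≡ lookup F e ∧ not (hd e == t)
    lookup-F₁ e = trans (lookup-∩ F _ e) (cong (lookup F e ∧_)
      (trans (lookup-∁ (inEdges D t) e) (cong not (lookup-inEdges t e))))

    lookup-F₂ : ∀ e → lookup F₂ e ≡ lookup F e ∧ (hd e == t)
    lookup-F₂ e = trans (lookup-∩ F _ e) (cong (lookup F e ∧_) (lookup-inEdges t e))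

    F≈ₜF₁ : F ≈ₜ F₁
    F≈ₜF₁ = agree-off-t λ e hd≢t → sym (trans (lookup-F₁ e)
      (trans (cong (λ b → lookup F e ∧ not b) (≢⇒==false hd≢t)) (∧-identityʳ _)))

    F₁-flame : MaxFlameMinus D t F₁
    F₁-flame = F₁⊆D∖t , λ v v≢r v≢t → flameAt-transfer allEdges≈ₜD∖t F≈ₜF₁ v≢t (proj₂ flame v v≢r tt)
      where
      F₁⊆D∖t : F₁ ⊆ edgesMinus D t
      F₁⊆D∖t {e} e∈F₁ = lookup⇒∈ (hd≢t⇒D∖t e λ hd≡t →
        true≢false (∧-conicalʳ (lookup F e) _ (trans (sym (lookup-F₁ e)) (∈⇒lookup e∈F₁)))
                   (cong not (≡⇒==true hd≡t)))

    F₂-base : BaseG D t F₂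
    F₂-base = independent-by-last-edges F₂ F₂⊆in refl F-paths (λ i → trans (lookup-F₂ _) (lastEdge-into-t i)) , maximal
      where
      λD : IsLambda D (allEdges D) t ∣ F₂ ∣
      λD = proj₁ (proj₂ flame t t≢root tt)
      λF : IsLambda D F t ∣ F₂ ∣
      λF = proj₂ (proj₂ flame t t≢root tt)
      F-paths : DisjointPaths (lookup F) t ∣ F₂ ∣ (proj₁ (lambda-paths λF))
      F-paths = proj₂ (lambda-paths λF)
      open LastEdges F-paths
      F₂⊆in : F₂ ⊆ inEdges D t
      F₂⊆in {e} e∈F₂ = lookup⇒∈ (trans (lookup-inEdges t e)
        (∧-conicalʳ (lookup F e) _ (trans (sym (lookup-F₂ e)) (∈⇒lookup e∈F₂))))
      maximal : ∀ Y → IndepG D t Y → F₂ ⊆ Y → Y ⊆ F₂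
      maximal Y (_ , _ , Y-paths , _) F₂⊆Y = ⊆-card-≤⇒⊇ F₂⊆Y (lambda-bound λD (toDisjointPaths Y-paths))

    split : Σ (Subset m) λ F₁ → Σ (Subset m) λ F₂ →
      MaxFlameMinus D t F₁ × BaseG D t F₂ × (F₁ ∩ F₂ ≡ ⊥) × (F ≡ F₁ ∪ F₂)
    split = F₁ , F₂ , F₁-flame , F₂-base , split-by-disjoint F (inEdges D t) , split-by F (inEdges D t)

  flow-value-at-sink : ∀ {S k f} → Flow S t k f → count (λ e → f e ∧ (hd e == t)) ≡ k
  flow-value-at-sink {S} {k} {f} fl = begin
    count (λ e → f e ∧ (hd e == t))  ≡⟨ count-cong into-T ⟩
    ϱ f T                            ≡⟨ Flow.balance fl T (≢⇒==false (t≢root ∘ sym)) ⟩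
    δ f T + χ (T t) * k              ≡⟨ cong₂ (λ d b → d + χ b * k) δ≡0 (==-refl t) ⟩
    k + 0                            ≡⟨ +-identityʳ k ⟩
    k                                ∎
    where
    open ≡-Reasoning
    T : VertexSet
    T u = u == t
    into-T : ∀ e → f e ∧ (hd e == t) ≡ f e ∧ enters T e
    into-T e rewrite ≢⇒==false (sink e) = refl
    δ≡0 : δ f T ≡ 0
    δ≡0 = trans (count-cong none) (count-false {m})
      where
      none : ∀ e → f e ∧ leaves T e ≡ false
      none e rewrite ≢⇒==false (sink e) = ∧-zeroʳ (f e)

  -- If some family beat |X|, augmenting X's flow would give |X| + 1 paths whose last
  -- edges form an independent set strictly containing X.
  base-bounds-paths : ∀ {X} → BaseG D t X → ∀ {j Q} → DisjointPaths (lookup (allEdges D)) t j Q → j ≤ ∣ X ∣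
  base-bounds-paths {X} ((_ , PX , X-paths₀ , covers , _) , maximal) {j} Q-paths =
    [ ⊥-elim ∘ no-larger-independent-set , cut-bound ]′ (augment X-flow)
    where
    X-paths : DisjointPaths (lookup (allEdges D)) t ∣ X ∣ PX
    X-paths = toDisjointPaths X-paths₀
    X-flow : Flow (lookup (allEdges D)) t ∣ X ∣ (⋃ PX)
    X-flow = disjointPaths⇒flow ∣ X ∣ PX X-paths

    cut-bound : reachable _ (⋃ PX) t ≡ false → j ≤ ∣ X ∣
    cut-bound saturated = ≤-trans (disjointPaths≤ϱ Q-paths cut cut-root cut-v) (≤-reflexive ϱS≡value)
      where open SaturatedCut X-flow saturated

    no-larger-independent-set : Augmentation _ t ∣ X ∣ (⋃ PX) → Empty
    no-larger-independent-set aug =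
      <⇒≱ (s≤s ≤-refl) (subst (_≤ ∣ X ∣) ∣Y∣≡1+∣X∣ (p⊆q⇒∣p∣≤∣q∣ (maximal Y Y-independent X⊆Y)))
      where
      open Augmentation aug
      Y : Subset m
      Y = tabulate λ e → larger e ∧ (hd e == t)
      lookup-Y : ∀ e → lookup Y e ≡ larger e ∧ (hd e == t)
      lookup-Y = lookup∘tabulate _
      ∣Y∣≡1+∣X∣ : ∣ Y ∣ ≡ suc ∣ X ∣
      ∣Y∣≡1+∣X∣ = trans (∣∣≡count Y) (trans (count-cong lookup-Y) (flow-value-at-sink larger-flow))
      Y⊆in : Y ⊆ inEdges D t
      Y⊆in {e} e∈Y = lookup⇒∈ (trans (lookup-inEdges t e)
        (∧-conicalʳ (larger e) _ (trans (sym (lookup-Y e)) (∈⇒lookup e∈Y))))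
      Y-paths : DisjointPaths larger t (suc ∣ X ∣) (proj₁ (flow⇒disjointPaths (suc ∣ X ∣) larger larger-flow))
      Y-paths = proj₂ (flow⇒disjointPaths (suc ∣ X ∣) larger larger-flow)
      Y-independent : IndepG D t Y
      Y-independent = independent-by-last-edges Y Y⊆in ∣Y∣≡1+∣X∣ Y-paths λ i → trans (lookup-Y _) (lastEdge-into-t i)
        where open LastEdges Y-paths
      X⊆Y : X ⊆ Y
      X⊆Y {e} e∈X = lookup⇒∈ (trans (lookup-Y e) (cong₂ _∧_ (keeps-into-v e in-X-flow hd≡t) (≡⇒==true hd≡t)))
        where
        open LastEdges X-paths
        i = proj₁ (covers e e∈X)
        last≡e : lastEdge i ≡ e
        last≡e = just-injective (trans (sym (lastEdge-last i)) (proj₂ (covers e e∈X)))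
        hd≡t : hd e ≡ t
        hd≡t = subst (λ x → hd x ≡ t) last≡e (lastEdge-hd i)
        in-X-flow : ⋃ PX e ≡ true
        in-X-flow = anyᶠ-intro _ i (∈⇒∈ᵇ (PX i) (subst (_∈ₗ PX i) last≡e (lastEdge-∈ i)))

  module FlameWithBase (F₁ X : Subset m) (flame : MaxFlameMinus D t F₁) (base : BaseG D t X) where

    S : EdgeSet
    S e = lookup F₁ e ∨ lookup X e

    F₁⊆S : lookup F₁ ⊆ᵉ S
    F₁⊆S e e∈ rewrite e∈ = refl

    X⊆S : lookup X ⊆ᵉ S
    X⊆S e e∈ rewrite e∈ = ∨-zeroʳ (lookup F₁ e)

    F₁⊆D∖t : lookup F₁ ⊆ᵉ D∖t
    F₁⊆D∖t e e∈ = ∈⇒lookup (proj₁ flame (lookup⇒∈ e∈))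

    X-hd : ∀ e → lookup X e ≡ true → hd e ≡ t
    X-hd e e∈ = ==⇒≡ (trans (sym (lookup-inEdges t e)) (∈⇒lookup (proj₁ (proj₁ base) (lookup⇒∈ e∈))))

    PX : Fin ∣ X ∣ → List (Fin m)
    PX = proj₁ (proj₂ (proj₁ base))

    X-paths : DisjointPaths (lookup (allEdges D)) t ∣ X ∣ PX
    X-paths = toDisjointPaths (proj₁ (proj₂ (proj₂ (proj₁ base))))

    X-ends-inside : ∀ i e → last (PX i) ≡ just e → e ∈ X
    X-ends-inside = proj₂ (proj₂ (proj₂ (proj₂ (proj₁ base))))

    F₁-λ : ∀ w → w ≢ root → w ≢ t → IsLambda D F₁ w (indeg D F₁ w)
    F₁-λ w w≢r w≢t = proj₂ (proj₂ flame w w≢r w≢t)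

    F₁-P : ∀ w → w ≢ root → w ≢ t → Fin (indeg D F₁ w) → List (Fin m)
    F₁-P w w≢r w≢t = proj₁ (lambda-paths (F₁-λ w w≢r w≢t))

    F₁-paths : ∀ w (w≢r : w ≢ root) (w≢t : w ≢ t) → DisjointPaths (lookup F₁) w (indeg D F₁ w) (F₁-P w w≢r w≢t)
    F₁-paths w w≢r w≢t = proj₂ (lambda-paths (F₁-λ w w≢r w≢t))

    record TightSet (e : Fin m) : Set where
      field
        W : VertexSet
        W-root : W root ≡ false
        W-hd : W (hd e) ≡ true
        W-tl : W (tl e) ≡ true
        ϱS-W≤ : ϱ S W ≤ indeg D F₁ (hd e)

    -- The cut found when F₁'s paths to w = hd e cannot be augmented inside D - t: it has
    -- in-degree ϱ_{F₁}(w), and it contains tl e, for otherwise e would have to be in F₁.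
    tight-set-around : ∀ e → S e ≡ false → (hd≢t : hd e ≢ t) → (hd≢r : hd e ≢ root) → TightSet e
    tight-set-around e e∉S hd≢t hd≢r = [ ⊥-elim ∘ too-many-paths , tight ]′ (augment g-flow)
      where
      g-flow : Flow D∖t (hd e) (indeg D F₁ (hd e)) (⋃ (F₁-P (hd e) hd≢r hd≢t))
      g-flow = disjointPaths⇒flow _ _ (disjointPaths-mono F₁⊆D∖t (F₁-paths (hd e) hd≢r hd≢t))

      too-many-paths : Augmentation D∖t (hd e) _ _ → Empty
      too-many-paths aug = <⇒≱ ≤-refl (lambda-bound (proj₁ (proj₂ flame (hd e) hd≢r hd≢t))
        (disjointPaths-mono (Flow.⊆S larger-flow) (proj₂ (flow⇒disjointPaths _ larger larger-flow))))
        where open Augmentation aug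

      tight : reachable D∖t _ (hd e) ≡ false → TightSet e
      tight saturated = record
        { W = W ; W-root = cong (_∧ _) cut-root ; W-hd = cong₂ _∧_ cut-v (cong not (≢⇒==false hd≢t))
        ; W-tl = cong₂ _∧_ tl-in-cut (cong not (≢⇒==false (sink e)))
        ; ϱS-W≤ = ≤-trans (count-mono W-entry⇒cut-entry) (≤-reflexive ϱS≡value) }
        where
        open SaturatedCut g-flow saturated
        W : VertexSet
        W u = cut u ∧ not (u == t)
        tl-in-cut : cut (tl e) ≡ true
        tl-in-cut = ¬-not λ tl∉ → true≢false
          (F₁⊆S e (⋃-⊆ (F₁-paths (hd e) hd≢r hd≢t) e
            (entering-S⇒f e (hd≢t⇒D∖t e hd≢t) (cong₂ _∧_ (cong not tl∉) cut-v))))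
          e∉S
        W-entry⇒cut-entry : ∀ x → S x ∧ enters W x ≡ true → D∖t x ∧ enters cut x ≡ true
        W-entry⇒cut-entry x entry = cong₂ _∧_ (F₁⊆D∖t x x∈F₁) (cong₂ _∧_ tl-outside hd-inside)
          where
          enters-W = ∧-conicalʳ (S x) _ entry
          W-at-hd = ∧-conicalʳ (not (W (tl x))) _ enters-W
          hd-inside : cut (hd x) ≡ true
          hd-inside = ∧-conicalˡ _ _ W-at-hd
          x-hd≢t : hd x ≢ t
          x-hd≢t hd≡t = true≢false (∧-conicalʳ (cut (hd x)) _ W-at-hd) (cong not (≡⇒==true hd≡t))
          x∈F₁ : lookup F₁ x ≡ true
          x∈F₁ = ¬-not λ x∉F₁ → x-hd≢t (X-hd x (trans (cong (_∨ lookup X x) (sym x∉F₁)) (∧-conicalˡ (S x) _ entry)))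
          tl-outside : not (cut (tl x)) ≡ true
          tl-outside = trans (cong not (sym (trans (cong (λ b → cut (tl x) ∧ not b) (≢⇒==false (sink x))) (∧-identityʳ _))))
                             (∧-conicalˡ _ _ enters-W)

    -- Uncrossing the saturated cut Z of a too-small flow with a tight set W around an edge of an
    -- X-path that leaves S yields a cut Z ∪ W that is still tight yet contains a residually
    -- reachable vertex.
    no-small-saturated-flow : ∀ {j f} → Flow S t j f → reachable S f t ≡ false → j < ∣ X ∣ → Empty
    no-small-saturated-flow {j} {f} fl saturated j<∣X∣ = let (i , e∉S) = crossing-outside-S in uncross i e∉S
      where
      open SaturatedCut fl saturated
      open CrossingEdges X-paths cut cut-root cut-v

      crossing-outside-S : Σ (Fin ∣ X ∣) λ i → S (crossingEdge i) ≡ false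
      crossing-outside-S with anyᶠ (λ i → not (S (crossingEdge i))) in outside
      ... | true = let (i , hit) = anyᶠ-witness (λ i → not (S (crossingEdge i))) outside in i , not-injective hit
      ... | false = ⊥-elim (<⇒≱ j<∣X∣ (≤-trans (injection⇒≤count crossingEdge crossingEdge-injective _ in-S)
                                               (≤-reflexive ϱS≡value)))
        where
        in-S : ∀ i → S (crossingEdge i) ∧ enters cut (crossingEdge i) ≡ true
        in-S i = cong₂ _∧_ (not-injective (anyᶠ-false _ outside i)) (crossingEdge-enters i)

      uncross : ∀ i → S (crossingEdge i) ≡ false → Empty
      uncross i e∉S = true≢false (not-injective tl-outside) tl-unreached
        where
        e = crossingEdge i
        tl-outside : cut (tl e) ≡ false
        tl-outside = not-injective (∧-conicalˡ _ _ (crossingEdge-enters i))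
        hd-inside : cut (hd e) ≡ true
        hd-inside = ∧-conicalʳ (not (cut (tl e))) _ (crossingEdge-enters i)
        hd≢t : hd e ≢ t
        hd≢t hd≡t = true≢false (X⊆S e (∈⇒lookup (X-ends-inside i e
          (chain-to-t-ends (proj₁ (proj₂ (proj₁ X-paths i))) e (proj₁ (proj₂ (crossing i))) hd≡t)))) e∉S
        hd≢r : hd e ≢ root
        hd≢r hd≡r = true≢false hd-inside (trans (cong cut hd≡r) cut-root)
        open TightSet (tight-set-around e e∉S hd≢t hd≢r)
        d = indeg D F₁ (hd e)
        d≤ϱS-Z∩W : d ≤ ϱ S (cut ∩ᵛ W)
        d≤ϱS-Z∩W = disjointPaths≤ϱ (disjointPaths-mono F₁⊆S (F₁-paths (hd e) hd≢r hd≢t))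
          (cut ∩ᵛ W) (cong (_∧ W root) cut-root) (cong₂ _∧_ hd-inside W-hd)
        ϱS-Z∪W≤j : ϱ S (cut ∪ᵛ W) ≤ j
        ϱS-Z∪W≤j = +-cancelʳ-≤ d _ _ (begin
          ϱ S (cut ∪ᵛ W) + d                      ≤⟨ +-monoʳ-≤ (ϱ S (cut ∪ᵛ W)) d≤ϱS-Z∩W ⟩
          ϱ S (cut ∪ᵛ W) + ϱ S (cut ∩ᵛ W)         ≤⟨ ϱ-submodular S cut W ⟩
          ϱ S cut + ϱ S W                         ≤⟨ +-monoʳ-≤ (ϱ S cut) ϱS-W≤ ⟩
          ϱ S cut + d                             ≡⟨ cong (_+ d) ϱS≡value ⟩
          j + d                                   ∎)
          where open ≤-Reasoning
        tl-unreached : reachable S f (tl e) ≡ false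
        tl-unreached = tight-cut-unreachable fl (cut ∪ᵛ W) (cong₂ _∨_ cut-root W-root) (cong (_∨ W t) cut-v) ϱS-Z∪W≤j
          (tl e) (trans (cong (cut (tl e) ∨_) W-tl) (∨-zeroʳ _))

    carries-paths : Σ (Fin ∣ X ∣ → List (Fin m)) (DisjointPaths S t ∣ X ∣)
    carries-paths with maximumFlow S t t≢root
    ... | record { value = j ; edges = f ; is-flow = fl ; saturated = saturated } with ∣ X ∣ ≤? j
    ...   | yes ∣X∣≤j =
      _ , disjointPaths-take ∣X∣≤j (disjointPaths-mono (Flow.⊆S fl) (proj₂ (flow⇒disjointPaths j f fl)))
    ...   | no ∣X∣≰j = ⊥-elim (no-small-saturated-flow fl saturated (≰⇒> ∣X∣≰j))

  module Joining (F₁ F₂ : Subset m) (flame : MaxFlameMinus D t F₁) (base : BaseG D t F₂) where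
    open FlameWithBase F₁ F₂ flame base

    F : Subset m
    F = F₁ ∪ F₂

    F₂-off-t : ∀ e → hd e ≢ t → lookup F₂ e ≡ false
    F₂-off-t e hd≢t = ¬-not λ e∈ → hd≢t (X-hd e e∈)

    F₁≈ₜF : F₁ ≈ₜ F
    F₁≈ₜF = agree-off-t λ e hd≢t → sym (trans (lookup-∪ F₁ F₂ e)
      (trans (cong (lookup F₁ e ∨_) (F₂-off-t e hd≢t)) (∨-identityʳ _)))

    F-into-t : ∀ e → lookup F e ∧ (hd e == t) ≡ lookup F₂ e
    F-into-t e with hd e ≟ t
    ... | yes hd≡t = trans (∧-identityʳ _) (trans (lookup-∪ F₁ F₂ e)
          (cong (_∨ lookup F₂ e) (¬-not λ e∈F₁ → D∖t⇒hd≢t e (F₁⊆D∖t e e∈F₁) hd≡t)))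
    ... | no hd≢t = trans (∧-zeroʳ _) (sym (F₂-off-t e hd≢t))

    ∣F₂∣≡indeg : ∣ F₂ ∣ ≡ indeg D F t
    ∣F₂∣≡indeg = trans (∣∣≡count F₂) (sym (trans (indeg≡count F t) (count-cong F-into-t)))

    λ-D : IsLambda D (allEdges D) t ∣ F₂ ∣
    λ-D = isLambda X-paths (base-bounds-paths base)

    λ-F : IsLambda D F t ∣ F₂ ∣
    λ-F = isLambda (disjointPaths-mono (λ e e∈ → trans (lookup-∪ F₁ F₂ e) e∈) (proj₂ carries-paths)) ends-bound
      where
      ends-bound : ∀ {j Q} → DisjointPaths (lookup F) t j Q → j ≤ ∣ F₂ ∣
      ends-bound paths = ≤-trans (injection⇒≤count lastEdge lastEdge-injective (lookup F₂)
                                    (λ i → trans (sym (F-into-t _)) (lastEdge-into-t i)))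
                                 (≤-reflexive (sym (∣∣≡count F₂)))
        where open LastEdges paths

    F-flame : MaxFlame D F
    F-flame = (λ {e} _ → lookup⇒∈ (lookup-allEdges e)) , λ v v≢r _ → flame-at v v≢r (v ≟ t)
      where
      flame-at : ∀ v → v ≢ root → Dec (v ≡ t) → FlameAt (allEdges D) F v
      flame-at v v≢r (yes refl) = subst (λ K → IsLambda D (allEdges D) t K × IsLambda D F t K) ∣F₂∣≡indeg (λ-D , λ-F)
      flame-at v v≢r (no v≢t) = flameAt-transfer (≈ₜ-sym allEdges≈ₜD∖t) F₁≈ₜF v≢t (proj₂ flame v v≢r v≢t)

theorem3 : (D : RootedDigraph) → (t : Fin (RootedDigraph.n D)) →
    t ≢ RootedDigraph.root D → IsSink D t →
    (F : Subset (RootedDigraph.m D)) →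
    MaxFlame D F ⇔
      Σ (Subset (RootedDigraph.m D)) (λ F₁ → Σ (Subset (RootedDigraph.m D)) (λ F₂ →
        MaxFlameMinus D t F₁ × BaseG D t F₂ × (F₁ ∩ F₂ ≡ ⊥) × (F ≡ F₁ ∪ F₂)))
theorem3 D t t≢root sink F = mk⇔
  (λ flame → Splitting.split F flame)
  (λ (F₁ , F₂ , flame , base , _ , F≡F₁∪F₂) →
     subst (MaxFlame D) (sym F≡F₁∪F₂) (Joining.F-flame F₁ F₂ flame base))
  where open SinkSplitting D t t≢root sink
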